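{- For every $n\ge2$, every isomorphism class of (unlabelled) lattices on $n$ elements contains a unique canonical $n$-lattice.
   Context: An $n$-poset ($n\ge2$) is a finite poset whose $n$ elements are labelled $0,1,\ldots,n-1$, where $0$ is the least element and $1$ is the greatest element; an $n$-lattice is an $n$-poset that is a lattice. For $a\in L$, $\mathrm{cov}_L(a)$ is the set of elements covering $a$. The depth $\mathrm{dep}_L(a)$ is the integer $p$ such that $p+1$ is the maximum number of elements of a chain in $L$ with least element $a$ and greatest element $1$. $\mathrm{lev}_k(L)=\{a:\mathrm{dep}_L(a)=k\}$. $L$ is levellised if $\mathrm{dep}_L(i)\le\mathrm{dep}_L(j)$ whenever $0<i\le j<n$. $\mathrm{wt}(A)=\sum_{j\in A}2^j$; $\mathrm{cov}^d_L(i)=\mathrm{cov}_L(i)\cap\mathrm{lev}_d(L)$. For a levellised $n$-lattice $L$ with $n>2$ and $k=\mathrm{dep}_L(n-1)$, $L'$ is the subposet induced by all elements of depth $\neq k$ (a levellised $n'$-lattice, $n'<n$). The relation $<$ on levellised $n$-lattices isomorphic as unlabelled lattices is defined by induction on $n$ (trivial for $n=2$): $L_1<L_2$ iff either $L_1'<L_2'$, or $L_1'=L_2'$ and, with $k=\mathrm{dep}_{L_1}(n-1)=\mathrm{dep}_{L_2}(n-1)$ and $\mathrm{lev}_k(L_1)=\mathrm{lev}_k(L_2)=\{a_k,\ldots,n-1\}$, there exist $\ell\in\{1,\ldots,k-1\}$ and $i\in\{a_k,\ldots,n-1\}$ with $\mathrm{wt}(\mathrm{cov}^d_{L_1}(j))=\mathrm{wt}(\mathrm{cov}^d_{L_2}(j))$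 whenever $d>\ell$, or $d=\ell$ and $j\in\{a_k,\ldots,i-1\}$, and $\mathrm{wt}(\mathrm{cov}^\ell_{L_1}(i))<\mathrm{wt}(\mathrm{cov}^\ell_{L_2}(i))$. An $n$-lattice $L$ is canonical if it is levellised and $<$-minimal among all levellised $n$-lattices isomorphic to $L$ as unlabelled lattices. -}

module Defs where

open import Data.Bool using (Bool; true; false; _∧_; not; if_then_else_)
open import Data.Nat using (ℕ; zero; suc; _+_; _^_; _≤_; _<_; _⊔_; _≡ᵇ_)
open import Data.Fin using (Fin; toℕ; fromℕ; inject≤) renaming (zero to fzero; suc to fsuc)
open import Data.Fin.Properties using (_≟_)
open import Data.Fin.Permutation using (Permutation′; _⟨$⟩ʳ_)
open import Data.List using (List; map; foldr; filterᵇ; allFin; length)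
open import Data.Bool.ListAction using (any)
open import Data.Nat.ListAction using (sum)
open import Data.Product using (Σ; _×_; ∃)
open import Relation.Binary.PropositionalEquality using (_≡_)
open import Relation.Nullary using (¬_; does)

-- A binary relation on the labels {0,…,n-1}; `R i j ≡ true` means i ≤ j.
BRel : ℕ → Set
BRel n = Fin n → Fin n → Bool

IsPartialOrder : ∀ {n} → BRel n → Set
IsPartialOrder {n} R =
  (∀ i → R i i ≡ true) ×
  (∀ i j → R i j ≡ true → R j i ≡ true → i ≡ j) ×
  (∀ i j k → R i j ≡ true → R j k ≡ true → R i k ≡ true)

IsUpperBound : ∀ {n} → BRel n → Fin n → Fin n → Fin n → Set
IsUpperBound R a b c = R a c ≡ true × R b c ≡ true

IsLowerBound : ∀ {n} → BRel n → Fin n → Fin n → Fin n → Set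
IsLowerBound R a b c = R c a ≡ true × R c b ≡ true

IsLattice : ∀ {n} → BRel n → Set
IsLattice {n} R =
  IsPartialOrder R ×
  (∀ a b → ∃ λ c → IsUpperBound R a b c × (∀ d → IsUpperBound R a b d → R c d ≡ true)) ×
  (∀ a b → ∃ λ c → IsLowerBound R a b c × (∀ d → IsLowerBound R a b d → R d c ≡ true))

𝟎 : ∀ {m} → Fin (suc (suc m))
𝟎 = fzero

𝟏 : ∀ {m} → Fin (suc (suc m))
𝟏 = fsuc fzero

IsNLattice : ∀ {m} → BRel (suc (suc m)) → Set
IsNLattice R = IsLattice R × (∀ a → R 𝟎 a ≡ true) × (∀ a → R a 𝟏 ≡ true)

strict : ∀ {n} → BRel n → Fin n → Fin n → Bool
strict R a b = R a b ∧ not (does (a ≟ b))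

maxL : List ℕ → ℕ
maxL = foldr _⊔_ 0

-- depthF f R a: the largest p such that there is a chain a = x0 < x1 < … < xp
-- in which xp has nothing strictly above it, restricted to chains of at most f steps.
depthF : ∀ {n} → ℕ → BRel n → Fin n → ℕ
depthF zero R a = 0
depthF {n} (suc f) R a =
  maxL (map (λ b → suc (depthF f R b)) (filterᵇ (strict R a) (allFin n)))

-- dep_L(a): in an n-poset the unique maximal element is 1, and every strict chain
-- has at most n-1 steps, so fuel n computes the maximal length of a chain from a to 1.
dep : ∀ {n} → BRel n → Fin n → ℕ
dep {n} R a = depthF n R a

-- covering relation: b covers a
covers : ∀ {n} → BRel n → Fin n → Fin n → Bool
covers {n} R a b = strict R a b ∧ not (any (λ c → strict R a c ∧ strict R c b) (allFin n))

wtCov : ∀ {n} → BRel n → ℕ → Fin n → ℕ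
wtCov {n} R d j =
  sum (map (λ c → if covers R j c ∧ (dep R c ≡ᵇ d) then 2 ^ toℕ c else 0) (allFin n))

Levellised : ∀ {n} → BRel n → Set
Levellised {n} R = ∀ (i j : Fin n) → 0 < toℕ i → toℕ i ≤ toℕ j → dep R i ≤ dep R j

lastF : ∀ {n} → Fin (suc n)
lastF {n} = fromℕ n

-- a_k = number of elements of depth ≠ k, k = dep(n-1); for a levellised L these
-- are exactly the labels 0,…,a_k-1, so L' is the restriction to the first a_k labels.
primeSize : ∀ {n} → BRel (suc n) → ℕ
primeSize {n} R = length (filterᵇ (λ i → not (dep R i ≡ᵇ dep R lastF)) (allFin (suc n)))

restrict : ∀ {a n} → .(a ≤ n) → BRel n → BRel a
restrict p R i j = R (inject≤ i p) (inject≤ j p)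

_≐_ : ∀ {n} → BRel n → BRel n → Set
R ≐ S = ∀ i j → R i j ≡ S i j

Iso : ∀ {n} → BRel n → BRel n → Set
Iso {n} R S = Σ (Permutation′ n) λ σ → ∀ i j → R i j ≡ S (σ ⟨$⟩ʳ i) (σ ⟨$⟩ʳ j)

-- the relation < on levellised n-lattices (defined by induction on n; empty for n = 2)
data _≺_ : ∀ {n} → BRel n → BRel n → Set where
  prime< : ∀ {m} {L₁ L₂ : BRel (suc (suc (suc m)))} (a : ℕ) (p : a ≤ suc (suc (suc m))) →
           primeSize L₁ ≡ a → primeSize L₂ ≡ a →
           restrict p L₁ ≺ restrict p L₂ →
           L₁ ≺ L₂
  level< : ∀ {m} {L₁ L₂ : BRel (suc (suc (suc m)))} (a : ℕ) (p : a ≤ suc (suc (suc m))) →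
           primeSize L₁ ≡ a → primeSize L₂ ≡ a →
           restrict p L₁ ≐ restrict p L₂ →
           (k : ℕ) → dep L₁ lastF ≡ k → dep L₂ lastF ≡ k →
           (ℓ : ℕ) → 1 ≤ ℓ → suc ℓ ≤ k →
           (i : Fin (suc (suc (suc m)))) → a ≤ toℕ i →
           (∀ (d : ℕ) (j : Fin (suc (suc (suc m)))) → ℓ < d → a ≤ toℕ j →
              wtCov L₁ d j ≡ wtCov L₂ d j) →
           (∀ (j : Fin (suc (suc (suc m)))) → a ≤ toℕ j → toℕ j < toℕ i →
              wtCov L₁ ℓ j ≡ wtCov L₂ ℓ j) →
           wtCov L₁ ℓ i < wtCov L₂ ℓ i →
           L₁ ≺ L₂

Canonical : ∀ {m} → BRel (suc (suc m)) → Set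
Canonical {m} C =
  IsNLattice C × Levellised C ×
  (∀ (D : BRel (suc (suc m))) → IsNLattice D → Levellised D → Iso D C → ¬ (D ≺ C))

module Submission where

-- The heart of the proof is `trichotomy`: two levellised n-lattices with the
-- same depths are equal or ≺-comparable.  It goes by induction on n: the
-- sublattices L′ are again levellised lattices with the same depths (`Prime`);
-- when the L′ agree, either the last-level covering weights agree, and then the
-- lattices coincide because these weights encode the covers in binary
-- (`Reconstruct`), or their first difference is a `level<` witness.
-- Isomorphic levellised n-lattices have the same depths (`iso⇒sameDepths`,
-- by counting initial segments), which gives uniqueness.  For existence, L is
-- relabelled into a levellised n-lattice (`Levellise`), and a ≺-least
-- admissible relabelling of it is found by scanning all functions
-- Fin n → Fin n (`Canonicalise`).

open import Defs
open import Data.Bool using (Bool; true; false; _∧_; _∨_; not; if_then_else_; T)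
open import Data.Bool.Properties using (¬-not; not-injective; ∧-conicalˡ; ∧-conicalʳ; ∧-identityʳ)
open import Data.Unit using (tt)
open import Data.Nat using (ℕ; zero; suc; _+_; _*_; _^_; _≤_; _<_; _⊔_; _∸_; _≡ᵇ_; z≤n; s≤s; _<?_; _≤?_)
open import Data.Nat.Properties hiding (_≟_)
open import Data.Nat.Properties using () renaming (_≟_ to _≟ℕ_)
open import Data.Fin using (Fin; toℕ; inject≤; fromℕ<; punchOut) renaming (zero to fzero; suc to fsuc)
open import Data.Fin.Properties
  using (_≟_; toℕ-injective; any?; all?; punchOut-injective; injective⇒≤; toℕ-fromℕ; toℕ≤pred[n]; toℕ<n;
         toℕ-inject≤; toℕ-fromℕ<; inject≤-injective)
open import Data.Fin.Permutation using (Permutation′; _⟨$⟩ʳ_; _⟨$⟩ˡ_; inverseʳ; inverseˡ; permutation)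
open import Data.List using (List; []; _∷_; map; filterᵇ; allFin; length; tabulate; cartesianProductWith)
open import Data.List.Membership.Propositional using (_∈_)
open import Data.List.Membership.Propositional.Properties
  using (∈-allFin; ∈-cartesianProductWith⁺; ∈-map⁺; ∈-map⁻; ∈-filter⁺; ∈-filter⁻)
open import Data.List.Properties using (foldr-preservesᵇ; foldr-preservesᵒ; map-cong)
import Data.List.Relation.Unary.Any as Any
import Data.List.Relation.Unary.All as All
import Data.Vec.Functional as Vector
import Data.Bool.Properties as Bool
open import Data.List.Relation.Unary.Any.Properties using (any⁺; any⁻)
open import Data.Bool.ListAction using (any; or)
open import Relation.Binary using (Tri; tri<; tri≈; tri>)
open import Data.Nat.ListAction using (sum)
open import Algebra.Properties.CommutativeMonoid.Sum +-0-commutativeMonoid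
  using (sum-cong-≗; sum-permute; sum-replicate-zero) renaming (sum to ∑)
open import Data.Product using (_×_; _,_; ∃; proj₁; proj₂)
open import Data.Sum using (_⊎_; inj₁; inj₂; [_,_]′)
open import Data.Empty using (⊥; ⊥-elim)
open import Function using (_∘_; id)
open import Relation.Nullary using (¬_; Dec; yes; no; does)
open import Relation.Nullary.Decidable using (dec-true; dec-false; T?; _→-dec_; _×-dec_)
open import Relation.Binary.PropositionalEquality
open import Data.Nat.Induction using (<-rec)

∧-intro : ∀ {a b} → a ≡ true → b ≡ true → a ∧ b ≡ true
∧-intro refl refl = refl

∧-elim : ∀ {a b} → a ∧ b ≡ true → a ≡ true × b ≡ true
∧-elim {a} {b} e = ∧-conicalˡ a b e , ∧-conicalʳ a b e

not-true : ∀ {a} → not a ≡ true → a ≡ false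
not-true {false} _ = refl

not-false : ∀ {a} → a ≡ false → not a ≡ true
not-false refl = refl

true≢false : ∀ {b} → b ≡ true → b ≡ false → ⊥
true≢false refl ()

bool-ext : ∀ {a b} → (a ≡ true → b ≡ true) → (b ≡ true → a ≡ true) → a ≡ b
bool-ext {true}  {true}  _ _ = refl
bool-ext {false} {false} _ _ = refl
bool-ext {true}  {false} f _ = sym (f refl)
bool-ext {false} {true}  _ g = g refl

≡true⇒T : ∀ {b} → b ≡ true → T b
≡true⇒T refl = tt

T⇒≡true : ∀ {b} → T b → b ≡ true
T⇒≡true {true} _ = refl

does⇒ : ∀ {A : Set} (d : Dec A) → does d ≡ true → A
does⇒ (yes a) _ = a

≡ᵇ⇒≡′ : ∀ x y → (x ≡ᵇ y) ≡ true → x ≡ y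
≡ᵇ⇒≡′ x y e = ≡ᵇ⇒≡ x y (≡true⇒T e)

≡⇒≡ᵇ′ : ∀ x y → x ≡ y → (x ≡ᵇ y) ≡ true
≡⇒≡ᵇ′ x y e = T⇒≡true (≡⇒≡ᵇ x y e)

≢⇒≡ᵇfalse : ∀ x y → x ≢ y → (x ≡ᵇ y) ≡ false
≢⇒≡ᵇfalse x y ne = ¬-not (ne ∘ ≡ᵇ⇒≡′ x y)

bit : Bool → ℕ
bit b = if b then 1 else 0

count : ∀ {n} → (Fin n → Bool) → ℕ
count P = ∑ (bit ∘ P)

bit-mono : ∀ {a b} → (a ≡ true → b ≡ true) → bit a ≤ bit b
bit-mono {false} _ = z≤n
bit-mono {true}  h rewrite h refl = ≤-refl

count-mono : ∀ {n} (P Q : Fin n → Bool) → (∀ i → P i ≡ true → Q i ≡ true) → count P ≤ count Q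
count-mono {zero}  P Q h = z≤n
count-mono {suc n} P Q h = +-mono-≤ (bit-mono (h fzero)) (count-mono (P ∘ fsuc) (Q ∘ fsuc) (h ∘ fsuc))

count-strict : ∀ {n} (P Q : Fin n → Bool) → (∀ i → P i ≡ true → Q i ≡ true) →
               ∀ b → P b ≡ false → Q b ≡ true → count P < count Q
count-strict {suc n} P Q h fzero pb qb rewrite pb | qb =
  s≤s (count-mono (P ∘ fsuc) (Q ∘ fsuc) (h ∘ fsuc))
count-strict {suc n} P Q h (fsuc b) pb qb =
  +-mono-≤-< (bit-mono (h fzero)) (count-strict (P ∘ fsuc) (Q ∘ fsuc) (h ∘ fsuc) b pb qb)

count-pos : ∀ {n} (P : Fin n → Bool) b → P b ≡ true → 0 < count P
count-pos P fzero    e rewrite e = s≤s z≤n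
count-pos P (fsuc b) e = ≤-trans (count-pos (P ∘ fsuc) b e) (m≤n+m _ (bit (P fzero)))

count-zero : ∀ {n} (P : Fin n → Bool) → (∀ i → P i ≡ false) → count P ≡ 0
count-zero {zero}  P h = refl
count-zero {suc n} P h rewrite h fzero = count-zero (P ∘ fsuc) (h ∘ fsuc)

count-≤ : ∀ {n} (P : Fin n → Bool) → count P ≤ n
count-≤ {zero}  P = z≤n
count-≤ {suc n} P = +-mono-≤ (bit≤1 (P fzero)) (count-≤ (P ∘ fsuc))
  where
  bit≤1 : ∀ b → bit b ≤ 1
  bit≤1 true  = ≤-refl
  bit≤1 false = z≤n

count-cong : ∀ {n} (P Q : Fin n → Bool) → (∀ i → P i ≡ Q i) → count P ≡ count Q
count-cong P Q h = sum-cong-≗ (cong bit ∘ h)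

count-permute : ∀ {n} (P : Fin n → Bool) (σ : Permutation′ n) → count (P ∘ (σ ⟨$⟩ʳ_)) ≡ count P
count-permute P σ = sym (sum-permute (bit ∘ P) σ)

length-filter-tabulate : ∀ {A : Set} {n} (P : A → Bool) (f : Fin n → A) →
                         length (filterᵇ P (tabulate f)) ≡ count (P ∘ f)
length-filter-tabulate {n = zero}  P f = refl
length-filter-tabulate {n = suc n} P f with P (f fzero)
... | true  = cong suc (length-filter-tabulate P (f ∘ fsuc))
... | false = length-filter-tabulate P (f ∘ fsuc)

length-filter-allFin : ∀ {n} (P : Fin n → Bool) → length (filterᵇ P (allFin n)) ≡ count P
length-filter-allFin P = length-filter-tabulate P id

sum-map-tabulate : ∀ {A : Set} {n} (g : A → ℕ) (f : Fin n → A) → sum (map g (tabulate f)) ≡ ∑ (g ∘ f)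
sum-map-tabulate {n = zero}  g f = refl
sum-map-tabulate {n = suc n} g f = cong (g (f fzero) +_) (sum-map-tabulate g (f ∘ fsuc))

sum-map-allFin : ∀ {n} (g : Fin n → ℕ) → sum (map g (allFin n)) ≡ ∑ g
sum-map-allFin g = sum-map-tabulate g id

-- A predicate closed downwards in the label order is an initial segment
-- {0,…,c-1}, and then c is its count.
InitialSegment : ∀ {n} → (Fin n → Bool) → Set
InitialSegment {n} P = ∀ (i j : Fin n) → P j ≡ true → toℕ i ≤ toℕ j → P i ≡ true

segment-tail : ∀ {n} {P : Fin (suc n) → Bool} → InitialSegment P → InitialSegment (P ∘ fsuc)
segment-tail seg i j pj le = seg (fsuc i) (fsuc j) pj (s≤s le)

segment-below : ∀ {n} (P : Fin n → Bool) → InitialSegment P → ∀ i → P i ≡ true → toℕ i < count P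
segment-below P seg fzero    e rewrite e = s≤s z≤n
segment-below P seg (fsuc i) e rewrite seg fzero (fsuc i) e z≤n =
  s≤s (segment-below (P ∘ fsuc) (segment-tail seg) i e)

segment-member : ∀ {n} (P : Fin n → Bool) → InitialSegment P → ∀ i → toℕ i < count P → P i ≡ true
segment-member {suc n} P seg i lt with P fzero in e0
segment-member {suc n} P seg fzero    lt        | true = e0
segment-member {suc n} P seg (fsuc i) (s≤s lt)  | true =
  segment-member (P ∘ fsuc) (segment-tail seg) i lt
... | false rewrite count-zero (P ∘ fsuc) (λ j → ¬-not (λ e → true≢false (seg fzero (fsuc j) e z≤n) e0))
  with () ← lt

segment-unique : ∀ {n} (P Q : Fin n → Bool) → InitialSegment P → InitialSegment Q →
                 count P ≡ count Q → ∀ i → P i ≡ Q i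
segment-unique P Q segP segQ e i = bool-ext
  (λ p → segment-member Q segQ i (subst (toℕ i <_) e (segment-below P segP i p)))
  (λ q → segment-member P segP i (subst (toℕ i <_) (sym e) (segment-below Q segQ i q)))

-- Binary weights: a subset of Fin n is determined by Σ_{c ∈ u} 2^c.

weight : ∀ {n} → (Fin n → Bool) → ℕ
weight u = ∑ (λ c → if u c then 2 ^ toℕ c else 0)

weight-suc : ∀ {n} (u : Fin (suc n) → Bool) → weight u ≡ bit (u fzero) + 2 * weight (u ∘ fsuc)
weight-suc u = cong (bit (u fzero) +_) (double (u ∘ fsuc) (λ c → 2 ^ toℕ c))
  where
  double : ∀ {n} (v : Fin n → Bool) (g : Fin n → ℕ) →
           ∑ (λ c → if v c then 2 * g c else 0) ≡ 2 * ∑ (λ c → if v c then g c else 0)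
  double {zero}  v g = refl
  double {suc n} v g with v fzero
  ... | true  = trans (cong (2 * g fzero +_) (double (v ∘ fsuc) (g ∘ fsuc))) (sym (*-distribˡ-+ 2 (g fzero) _))
  ... | false = double (v ∘ fsuc) (g ∘ fsuc)

bit-split : ∀ a b x y → bit a + 2 * x ≡ bit b + 2 * y → a ≡ b × x ≡ y
bit-split true  true  x y e = refl , *-cancelˡ-≡ x y 2 (suc-injective e)
bit-split false false x y e = refl , *-cancelˡ-≡ x y 2 e
bit-split true  false x y e = ⊥-elim (even≢odd y x (sym e))
bit-split false true  x y e = ⊥-elim (even≢odd x y e)

weight-injective : ∀ {n} (u v : Fin n → Bool) → weight u ≡ weight v → ∀ c → u c ≡ v c
weight-injective {suc n} u v e c
  with bit-split (u fzero) (v fzero) (weight (u ∘ fsuc)) (weight (v ∘ fsuc)) (trans (sym (weight-suc u)) (trans e (weight-suc v)))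
... | e₀ , eₛ with c
...   | fzero  = e₀
...   | fsuc c′ = weight-injective (u ∘ fsuc) (v ∘ fsuc) eₛ c′

maxOver : ∀ {n} → (Fin n → Bool) → (Fin n → ℕ) → ℕ
maxOver {n} P g = maxL (map g (filterᵇ P (allFin n)))

maxOver-ub : ∀ {n} (P : Fin n → Bool) (g : Fin n → ℕ) b → P b ≡ true → g b ≤ maxOver P g
maxOver-ub {n} P g b e = foldr-preservesᵒ {P = g b ≤_} {f = _⊔_}
  (λ x y → λ { (inj₁ le) → m≤n⇒m≤n⊔o y le ; (inj₂ le) → m≤n⇒m≤o⊔n x le }) 0
  (map g (filterᵇ P (allFin n)))
  (inj₂ (Any.map (λ { refl → ≤-refl }) (∈-map⁺ g (∈-filter⁺ (T? ∘ P) (∈-allFin b) (≡true⇒T e)))))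

maxOver-lub : ∀ {n} (P : Fin n → Bool) (g : Fin n → ℕ) c →
              (∀ b → P b ≡ true → g b ≤ c) → maxOver P g ≤ c
maxOver-lub {n} P g c h = foldr-preservesᵇ {P = _≤ c} {f = _⊔_} ⊔-lub z≤n (All.tabulate bounded)
  where
  bounded : ∀ {x} → x ∈ map g (filterᵇ P (allFin n)) → x ≤ c
  bounded m with b , mb , refl ← ∈-map⁻ g m = h b (T⇒≡true (proj₂ (∈-filter⁻ (T? ∘ P) {xs = allFin n} mb)))

maxOver-cong : ∀ {n} (P : Fin n → Bool) (g g′ : Fin n → ℕ) →
               (∀ b → P b ≡ true → g b ≡ g′ b) → maxOver P g ≡ maxOver P g′
maxOver-cong P g g′ e = ≤-antisym
  (maxOver-lub P g _ (λ b pb → ≤-trans (≤-reflexive (e b pb)) (maxOver-ub P g′ b pb)))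
  (maxOver-lub P g′ _ (λ b pb → ≤-trans (≤-reflexive (sym (e b pb))) (maxOver-ub P g b pb)))

maxOver-empty : ∀ {n} (P : Fin n → Bool) (g : Fin n → ℕ) → (∀ b → P b ≡ false) → maxOver P g ≡ 0
maxOver-empty P g h = n≤0⇒n≡0 (maxOver-lub P g 0 (λ b e → ⊥-elim (true≢false e (h b))))

module _ {n} (R : BRel n) where

  strict-intro : ∀ {a b} → R a b ≡ true → a ≢ b → strict R a b ≡ true
  strict-intro {a} {b} r ne rewrite r | dec-false (a ≟ b) ne = refl

  strict⇒≤ : ∀ {a b} → strict R a b ≡ true → R a b ≡ true
  strict⇒≤ e = proj₁ (∧-elim e)

  strict⇒≢ : ∀ {a b} → strict R a b ≡ true → a ≢ b
  strict⇒≢ {a} {b} e eq = true≢false (dec-true (a ≟ b) eq) (not-true (proj₂ (∧-elim e)))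

  strict-irrefl : ∀ a → strict R a a ≡ false
  strict-irrefl a = ¬-not (λ e → strict⇒≢ e refl)

module PartialOrder {n} (R : BRel n) (po : IsPartialOrder R) where

  R-refl : ∀ a → R a a ≡ true
  R-refl = proj₁ po

  R-antisym : ∀ a b → R a b ≡ true → R b a ≡ true → a ≡ b
  R-antisym = proj₁ (proj₂ po)

  R-trans : ∀ a b c → R a b ≡ true → R b c ≡ true → R a c ≡ true
  R-trans = proj₂ (proj₂ po)

  strict-trans : ∀ {a b c} → strict R a b ≡ true → strict R b c ≡ true → strict R a c ≡ true
  strict-trans {a} {b} {c} p q = strict-intro R (R-trans a b c (strict⇒≤ R p) (strict⇒≤ R q))
    (λ { refl → strict⇒≢ R p (R-antisym a b (strict⇒≤ R p) (strict⇒≤ R q)) })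

  ≤⇒≡⊎strict : ∀ {a b} → R a b ≡ true → a ≡ b ⊎ strict R a b ≡ true
  ≤⇒≡⊎strict {a} {b} r = split (a ≟ b)
    where
    split : Dec (a ≡ b) → a ≡ b ⊎ strict R a b ≡ true
    split (yes e) = inj₁ e
    split (no ne) = inj₂ (strict-intro R r ne)

  covers⇒strict : ∀ {a b} → covers R a b ≡ true → strict R a b ≡ true
  covers⇒strict e = proj₁ (∧-elim e)

  covers⇒nothing-between : ∀ {a b c} → covers R a b ≡ true →
                           strict R a c ≡ true → strict R c b ≡ true → ⊥
  covers⇒nothing-between {a} {b} {c} e s₁ s₂ = true≢false
    (T⇒≡true (any⁺ _ (Any.map (λ { refl → ≡true⇒T (∧-intro s₁ s₂) }) (∈-allFin c))))
    (not-true (proj₂ (∧-elim {strict R a b} e)))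

  covers-intro : ∀ {a b} → strict R a b ≡ true →
                 (∀ c → strict R a c ≡ true → strict R c b ≡ true → ⊥) → covers R a b ≡ true
  covers-intro {a} {b} s h = ∧-intro s (not-false (¬-not between))
    where
    between : ¬ (any (λ c → strict R a c ∧ strict R c b) (allFin n) ≡ true)
    between e with c , pc ← Any.satisfied (any⁻ _ (allFin n) (≡true⇒T e)) =
      h c (proj₁ (∧-elim {strict R a c} (T⇒≡true pc))) (proj₂ (∧-elim {strict R a c} (T⇒≡true pc)))

  ¬covers⇒between : ∀ {a b} → strict R a b ≡ true → covers R a b ≡ false →
                    ∃ λ c → strict R a c ≡ true × strict R c b ≡ true
  ¬covers⇒between {a} {b} s e with any (λ c → strict R a c ∧ strict R c b) (allFin n) in ea
  ... | true  = let c , pc = Any.satisfied (any⁻ _ (allFin n) (≡true⇒T ea)) in c , ∧-elim {strict R a c} (T⇒≡true pc)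
  ... | false = ⊥-elim (true≢false (∧-intro s refl) e)

  -- The number of elements strictly above x; it bounds the length of the
  -- chains starting at x, hence the fuel that `depthF` needs.
  up : Fin n → ℕ
  up x = count (strict R x)

  up-decreasing : ∀ {x b} → strict R x b ≡ true → up b < up x
  up-decreasing {x} {b} s = count-strict (strict R b) (strict R x) (λ i → strict-trans s) b (strict-irrefl R b) s

  -- Fuel beyond `up x` does not change `depthF`: the chains from x are shorter.
  depthF-stable : ∀ f x → up x ≤ f → depthF (suc f) R x ≡ depthF f R x
  depthF-stable zero    x le = maxOver-empty (strict R x) _
    (λ b → ¬-not (λ s → <-irrefl refl (≤-trans (count-pos (strict R x) b s) le)))
  depthF-stable (suc f) x le = maxOver-cong (strict R x) _ _
    (λ b s → cong suc (depthF-stable f b (≤-pred (≤-trans (up-decreasing s) le))))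

  depthF-stable+ : ∀ k f x → up x ≤ f → depthF (k + f) R x ≡ depthF f R x
  depthF-stable+ zero    f x le = refl
  depthF-stable+ (suc k) f x le =
    trans (depthF-stable (k + f) x (≤-trans le (m≤n+m f k))) (depthF-stable+ k f x le)

  dep-fuel : ∀ f x → n ≤ f → depthF f R x ≡ dep R x
  dep-fuel f x le = trans (cong (λ g → depthF g R x) (sym (m∸n+n≡m le)))
                          (depthF-stable+ (f ∸ n) n x (count-≤ (strict R x)))

  dep-unfold : ∀ x → dep R x ≡ maxOver (strict R x) (λ b → suc (dep R b))
  dep-unfold x = sym (dep-fuel (suc n) x (n≤1+n n))

  dep-strict : ∀ {x y} → strict R x y ≡ true → suc (dep R y) ≤ dep R x
  dep-strict {x} {y} s = ≤-trans (maxOver-ub (strict R x) (λ b → suc (dep R b)) y s) (≤-reflexive (sym (dep-unfold x)))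

  dep-lub : ∀ x c → (∀ b → strict R x b ≡ true → suc (dep R b) ≤ c) → dep R x ≤ c
  dep-lub x c h = ≤-trans (≤-reflexive (dep-unfold x)) (maxOver-lub (strict R x) (λ b → suc (dep R b)) c h)

  cover-below : ∀ x y → strict R x y ≡ true → ∃ λ c → covers R x c ≡ true × R c y ≡ true
  cover-below x y s = search (dep R x) x y s (m≤m+n _ _)
    where
    search : ∀ N x y → strict R x y ≡ true → dep R x ≤ N + dep R y →
             ∃ λ c → covers R x c ≡ true × R c y ≡ true
    search zero    x y s le = ⊥-elim (<-irrefl refl (≤-trans (dep-strict s) le))
    search (suc N) x y s le with covers R x y in cv
    ... | true  = y , cv , R-refl y
    ... | false with z , s₁ , s₂ ← ¬covers⇒between s cv
                with c , cc , rcz ← search N x z s₁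
                       (≤-trans le (≤-trans (≤-reflexive (sym (+-suc N (dep R y)))) (+-monoʳ-≤ N (dep-strict s₂))))
                = c , cc , R-trans c z y rcz (strict⇒≤ R s₂)

module Relabel {n} (R S : BRel n) (σ τ : Fin n → Fin n)
  (τσ : ∀ i → τ (σ i) ≡ i) (στ : ∀ j → σ (τ j) ≡ j) (RS : ∀ i j → R i j ≡ S (σ i) (σ j)) where

  ≟-relabel : ∀ a b → does (a ≟ b) ≡ does (σ a ≟ σ b)
  ≟-relabel a b with a ≟ b
  ... | yes refl = sym (dec-true (σ a ≟ σ a) refl)
  ... | no ne    = sym (dec-false (σ a ≟ σ b) (λ e → ne (trans (sym (τσ a)) (trans (cong τ e) (τσ b)))))

  strict-relabel : ∀ a b → strict R a b ≡ strict S (σ a) (σ b)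
  strict-relabel a b = cong₂ (λ u v → u ∧ not v) (RS a b) (≟-relabel a b)

  depthF-relabel : ∀ f i → depthF f R i ≡ depthF f S (σ i)
  depthF-relabel zero    i = refl
  depthF-relabel (suc f) i = ≤-antisym
    (maxOver-lub (strict R i) _ _ (λ b s →
      ≤-trans (≤-reflexive (cong suc (depthF-relabel f b)))
              (maxOver-ub (strict S (σ i)) _ (σ b) (trans (sym (strict-relabel i b)) s))))
    (maxOver-lub (strict S (σ i)) _ _ (λ b s →
      ≤-trans (≤-reflexive (cong suc (trans (cong (depthF f S) (sym (στ b))) (sym (depthF-relabel f (τ b))))))
              (maxOver-ub (strict R i) _ (τ b) (trans (strict-relabel i (τ b)) (trans (cong (strict S (σ i)) (στ b)) s)))))

  dep-relabel : ∀ i → dep R i ≡ dep S (σ i)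
  dep-relabel = depthF-relabel n

≐-refl : ∀ {n} {R : BRel n} → R ≐ R
≐-refl i j = refl

≐-sym : ∀ {n} {R S : BRel n} → R ≐ S → S ≐ R
≐-sym e i j = sym (e i j)

≐-trans : ∀ {n} {R S T : BRel n} → R ≐ S → S ≐ T → R ≐ T
≐-trans e f i j = trans (e i j) (f i j)

module Pointwise {n} (R S : BRel n) (RS : R ≐ S) where

  strict≐ : ∀ a b → strict R a b ≡ strict S a b
  strict≐ = Relabel.strict-relabel R S id id (λ _ → refl) (λ _ → refl) RS

  dep≐ : ∀ i → dep R i ≡ dep S i
  dep≐ = Relabel.dep-relabel R S id id (λ _ → refl) (λ _ → refl) RS

  covers≐ : ∀ a b → covers R a b ≡ covers S a b
  covers≐ a b = cong₂ (λ u v → u ∧ not v) (strict≐ a b)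
    (cong or (map-cong (λ c → cong₂ _∧_ (strict≐ a c) (strict≐ c b)) (allFin n)))

  wtCov≐ : ∀ d j → wtCov R d j ≡ wtCov S d j
  wtCov≐ d j = cong sum (map-cong
    (λ c → cong₂ (λ u v → if u ∧ v then 2 ^ toℕ c else 0) (covers≐ j c) (cong (_≡ᵇ d) (dep≐ c)))
    (allFin n))

inPrime : ∀ {n} → BRel (suc n) → Fin (suc n) → Bool
inPrime R i = not (dep R i ≡ᵇ dep R lastF)

primeSize≡count : ∀ {n} (R : BRel (suc n)) → primeSize R ≡ count (inPrime R)
primeSize≡count R = length-filter-allFin (inPrime R)

primeSize≐ : ∀ {n} (R S : BRel (suc n)) → R ≐ S → primeSize R ≡ primeSize S
primeSize≐ R S e = begin
  primeSize R       ≡⟨ primeSize≡count R ⟩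
  count (inPrime R) ≡⟨ count-cong _ _ (λ i → cong₂ (λ u v → not (u ≡ᵇ v)) (dep≐ i) (dep≐ lastF)) ⟩
  count (inPrime S) ≡⟨ primeSize≡count S ⟨
  primeSize S       ∎
  where
  open Pointwise R S e
  open ≡-Reasoning

restrict≐ : ∀ {a n} .(p : a ≤ n) {R S : BRel n} → R ≐ S → restrict p R ≐ restrict p S
restrict≐ p e i j = e (inject≤ i p) (inject≤ j p)

Join : ∀ {n} → BRel n → Fin n → Fin n → Set
Join R x y = ∃ λ c → IsUpperBound R x y c × (∀ d → IsUpperBound R x y d → R c d ≡ true)

Meet : ∀ {n} → BRel n → Fin n → Fin n → Set
Meet R x y = ∃ λ c → IsLowerBound R x y c × (∀ d → IsLowerBound R x y d → R d c ≡ true)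

iso-refl : ∀ {n} {R : BRel n} → Iso R R
iso-refl = permutation id id (λ _ → refl) (λ _ → refl) , λ i j → refl

iso-sym : ∀ {n} {R S : BRel n} → Iso R S → Iso S R
iso-sym {S = S} (π , p) =
  permutation (π ⟨$⟩ˡ_) (π ⟨$⟩ʳ_) (λ _ → inverseˡ π) (λ _ → inverseʳ π) ,
  λ x y → trans (sym (cong₂ S (inverseʳ π) (inverseʳ π))) (sym (p (π ⟨$⟩ˡ x) (π ⟨$⟩ˡ y)))

iso-trans : ∀ {n} {R S T : BRel n} → Iso R S → Iso S T → Iso R T
iso-trans (π , p) (ρ , q) =
  permutation (λ i → ρ ⟨$⟩ʳ (π ⟨$⟩ʳ i)) (λ k → π ⟨$⟩ˡ (ρ ⟨$⟩ˡ k))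
    (λ k → trans (cong (ρ ⟨$⟩ʳ_) (inverseʳ π)) (inverseʳ ρ))
    (λ i → trans (cong (π ⟨$⟩ˡ_) (inverseˡ ρ)) (inverseˡ π)) ,
  λ i j → trans (p i j) (q (π ⟨$⟩ʳ i) (π ⟨$⟩ʳ j))

module _ {n} {R S : BRel n} (iso : Iso R S) where
  private
    π = proj₁ iso
    σ τ : Fin n → Fin n
    σ = π ⟨$⟩ʳ_
    τ = π ⟨$⟩ˡ_

    S≡R : ∀ x y → S x y ≡ R (τ x) (τ y)
    S≡R = proj₂ (iso-sym iso)

    S≡Rʳ : ∀ x z → S x (σ z) ≡ R (τ x) z
    S≡Rʳ x z = trans (S≡R x (σ z)) (cong (R (τ x)) (inverseˡ π))

    S≡Rˡ : ∀ z y → S (σ z) y ≡ R z (τ y)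
    S≡Rˡ z y = trans (S≡R (σ z) y) (cong (λ w → R w (τ y)) (inverseˡ π))

  iso-partialOrder : IsPartialOrder R → IsPartialOrder S
  iso-partialOrder (rf , as , tr) =
    (λ x → trans (S≡R x x) (rf (τ x))) ,
    (λ x y a b → trans (sym (inverseʳ π))
      (trans (cong σ (as (τ x) (τ y) (trans (sym (S≡R x y)) a) (trans (sym (S≡R y x)) b))) (inverseʳ π))) ,
    (λ x y z a b → trans (S≡R x z) (tr (τ x) (τ y) (τ z) (trans (sym (S≡R x y)) a) (trans (sym (S≡R y z)) b)))

  iso-lattice : IsLattice R → IsLattice S
  iso-lattice (po , joins , meets) = iso-partialOrder po , join , meet
    where
    join : ∀ a b → Join S a b
    join a b with z , (u₁ , u₂) , least ← joins (τ a) (τ b) =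
      σ z , (trans (S≡Rʳ a z) u₁ , trans (S≡Rʳ b z) u₂) ,
      λ d (v₁ , v₂) → trans (S≡Rˡ z d) (least (τ d) (trans (sym (S≡R a d)) v₁ , trans (sym (S≡R b d)) v₂))
    meet : ∀ a b → Meet S a b
    meet a b with z , (l₁ , l₂) , great ← meets (τ a) (τ b) =
      σ z , (trans (S≡Rˡ z a) l₁ , trans (S≡Rˡ z b) l₂) ,
      λ d (v₁ , v₂) → trans (S≡Rʳ d z) (great (τ d) (trans (sym (S≡R d a)) v₁ , trans (sym (S≡R d b)) v₂))

module NLattice {m} (C : BRel (suc (suc m))) (nl : IsNLattice C) where
  open PartialOrder C (proj₁ (proj₁ nl)) public

  bot : ∀ a → C 𝟎 a ≡ true
  bot = proj₁ (proj₂ nl)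

  top : ∀ a → C a 𝟏 ≡ true
  top = proj₂ (proj₂ nl)

  nothing-above-top : ∀ b → strict C 𝟏 b ≡ true → ⊥
  nothing-above-top b s = strict⇒≢ C s (R-antisym 𝟏 b (strict⇒≤ C s) (top b))

  nothing-below-bot : ∀ x → strict C x 𝟎 ≡ true → ⊥
  nothing-below-bot x s = strict⇒≢ C s (R-antisym x 𝟎 (strict⇒≤ C s) (bot x))

  strict-top : ∀ x → x ≢ 𝟏 → strict C x 𝟏 ≡ true
  strict-top x = strict-intro C (top x)

  strict-bot : ∀ x → 𝟎 ≢ x → strict C 𝟎 x ≡ true
  strict-bot x = strict-intro C (bot x)

  dep-top : dep C 𝟏 ≡ 0
  dep-top = n≤0⇒n≡0 (dep-lub 𝟏 0 (λ b s → ⊥-elim (nothing-above-top b s)))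

  dep≡0⇒top : ∀ x → dep C x ≡ 0 → x ≡ 𝟏
  dep≡0⇒top x e with ≤⇒≡⊎strict (top x)
  ... | inj₁ x≡1 = x≡1
  ... | inj₂ s   with () ← ≤-trans (dep-strict s) (≤-reflexive e)

  covers-top : ∀ j → covers C j 𝟏 ≡ (dep C j ≡ᵇ 1)
  covers-top j = bool-ext (λ cv → ≡⇒≡ᵇ′ _ _ (dep≡1 cv)) (λ e → covers≡true (≡ᵇ⇒≡′ _ _ e))
    where
    dep≡1 : covers C j 𝟏 ≡ true → dep C j ≡ 1
    dep≡1 cv = ≤-antisym (dep-lub j 1 below) (≤-trans (≤-reflexive (cong suc (sym dep-top))) (dep-strict (covers⇒strict cv)))
      where
      below : ∀ b → strict C j b ≡ true → suc (dep C b) ≤ 1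
      below b s with b ≟ 𝟏
      ... | yes refl = ≤-reflexive (cong suc dep-top)
      ... | no b≢1   = ⊥-elim (covers⇒nothing-between cv s (strict-top b b≢1))
    covers≡true : dep C j ≡ 1 → covers C j 𝟏 ≡ true
    covers≡true dj = covers-intro (strict-top j j≢1)
      (λ c s₁ s₂ → strict⇒≢ C s₂ (dep≡0⇒top c (n≤0⇒n≡0 (≤-pred (≤-trans (dep-strict s₁) (≤-reflexive dj))))))
      where
      j≢1 : j ≢ 𝟏
      j≢1 refl with () ← trans (sym dep-top) dj

resp≺ : ∀ {n} {L₁ L₂ L₁′ L₂′ : BRel n} → L₁ ≐ L₁′ → L₂ ≐ L₂′ → L₁ ≺ L₂ → L₁′ ≺ L₂′
resp≺ E₁ E₂ (prime< a p e₁ e₂ r) =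
  prime< a p (trans (sym (primeSize≐ _ _ E₁)) e₁) (trans (sym (primeSize≐ _ _ E₂)) e₂)
    (resp≺ (restrict≐ p E₁) (restrict≐ p E₂) r)
resp≺ E₁ E₂ (level< a p e₁ e₂ eqR k dk₁ dk₂ ℓ 1≤ℓ ℓ<k i ai above before lt) =
  level< a p (trans (sym (primeSize≐ _ _ E₁)) e₁) (trans (sym (primeSize≐ _ _ E₂)) e₂)
    (≐-trans (restrict≐ p (≐-sym E₁)) (≐-trans eqR (restrict≐ p E₂)))
    k (trans (sym (P₁.dep≐ lastF)) dk₁) (trans (sym (P₂.dep≐ lastF)) dk₂)
    ℓ 1≤ℓ ℓ<k i ai
    (λ d j ld aj → trans (sym (P₁.wtCov≐ d j)) (trans (above d j ld aj) (P₂.wtCov≐ d j)))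
    (λ j aj ji → trans (sym (P₁.wtCov≐ ℓ j)) (trans (before j aj ji) (P₂.wtCov≐ ℓ j)))
    (subst₂ _<_ (P₁.wtCov≐ ℓ i) (P₂.wtCov≐ ℓ i) lt)
  where
  module P₁ = Pointwise _ _ E₁
  module P₂ = Pointwise _ _ E₂

-- ≺ is irreflexive, even up to ≐: the comparison ends with a strict
-- inequality between equal weights.
≺-irrefl≐ : ∀ {n} {L₁ L₂ : BRel n} → L₁ ≺ L₂ → ¬ (L₁ ≐ L₂)
≺-irrefl≐ (prime< a p _ _ r) E = ≺-irrefl≐ r (restrict≐ p E)
≺-irrefl≐ (level< _ _ _ _ _ _ _ _ ℓ _ _ i _ _ _ lt) E = <-irrefl (Pointwise.wtCov≐ _ _ E ℓ i) lt

≺-irrefl : ∀ {n} {L : BRel n} → ¬ (L ≺ L)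
≺-irrefl r = ≺-irrefl≐ r ≐-refl

-- ≺ is transitive: compare the witnesses of the two steps, first by level
-- and then by position.
≺-trans : ∀ {n} {L₁ L₂ L₃ : BRel n} → L₁ ≺ L₂ → L₂ ≺ L₃ → L₁ ≺ L₃
≺-trans (prime< a p e₁ e₂ r) (prime< _ _ e₂′ e₃ r′) with refl ← trans (sym e₂) e₂′ =
  prime< a p e₁ e₃ (≺-trans r r′)
≺-trans (prime< a p e₁ e₂ r) (level< _ _ e₂′ e₃ eqR′ _ _ _ _ _ _ _ _ _ _ _) with refl ← trans (sym e₂) e₂′ =
  prime< a p e₁ e₃ (resp≺ ≐-refl eqR′ r)
≺-trans (level< a p e₁ e₂ eqR _ _ _ _ _ _ _ _ _ _ _) (prime< _ _ e₂′ e₃ r′) with refl ← trans (sym e₂) e₂′ =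
  prime< a p e₁ e₃ (resp≺ (≐-sym eqR) ≐-refl r′)
≺-trans (level< a p e₁ e₂ eqR k dk₁ dk₂ ℓ 1≤ℓ ℓ<k i ai above before lt)
        (level< _ _ e₂′ e₃ eqR′ _ dk₂′ dk₃ ℓ′ 1≤ℓ′ ℓ′<k i′ ai′ above′ before′ lt′)
  with refl ← trans (sym e₂) e₂′ | refl ← trans (sym dk₂) dk₂′ | <-cmp ℓ ℓ′
... | tri< ℓ<ℓ′ _ _ = level< a p e₁ e₃ (≐-trans eqR eqR′) k dk₁ dk₃ ℓ′ 1≤ℓ′ ℓ′<k i′ ai′
  (λ d j ld aj → trans (above d j (<-trans ℓ<ℓ′ ld) aj) (above′ d j ld aj))
  (λ j aj ji → trans (above ℓ′ j ℓ<ℓ′ aj) (before′ j aj ji))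
  (≤-trans (s≤s (≤-reflexive (above ℓ′ i′ ℓ<ℓ′ ai′))) lt′)
... | tri> _ _ ℓ′<ℓ = level< a p e₁ e₃ (≐-trans eqR eqR′) k dk₁ dk₃ ℓ 1≤ℓ ℓ<k i ai
  (λ d j ld aj → trans (above d j ld aj) (above′ d j (<-trans ℓ′<ℓ ld) aj))
  (λ j aj ji → trans (before j aj ji) (above′ ℓ j ℓ′<ℓ aj))
  (≤-trans lt (≤-reflexive (above′ ℓ i ℓ′<ℓ ai)))
... | tri≈ _ refl _ with <-cmp (toℕ i) (toℕ i′)
...   | tri< i<i′ _ _ = level< a p e₁ e₃ (≐-trans eqR eqR′) k dk₁ dk₃ ℓ 1≤ℓ ℓ<k i ai
  (λ d j ld aj → trans (above d j ld aj) (above′ d j ld aj))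
  (λ j aj ji → trans (before j aj ji) (before′ j aj (<-trans ji i<i′)))
  (≤-trans lt (≤-reflexive (before′ i ai i<i′)))
...   | tri> _ _ i′<i = level< a p e₁ e₃ (≐-trans eqR eqR′) k dk₁ dk₃ ℓ 1≤ℓ ℓ<k i′ ai′
  (λ d j ld aj → trans (above d j ld aj) (above′ d j ld aj))
  (λ j aj ji → trans (before j aj (<-trans ji i′<i)) (before′ j aj ji))
  (≤-trans (s≤s (≤-reflexive (before i′ ai′ i′<i))) lt′)
...   | tri≈ _ ii′ _ with refl ← toℕ-injective ii′ = level< a p e₁ e₃ (≐-trans eqR eqR′) k dk₁ dk₃ ℓ 1≤ℓ ℓ<k i ai
  (λ d j ld aj → trans (above d j ld aj) (above′ d j ld aj))
  (λ j aj ji → trans (before j aj ji) (before′ j aj ji))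
  (<-trans lt lt′)

-- Levellised-ness makes L′
-- (the elements of depth ≠ k) the initial segment {0,…,a-1}, where
-- a = primeSize, while every label ≥ a has depth exactly k.

module LevelStructure {m} (C : BRel (suc (suc (suc m)))) (nl : IsNLattice C) (lv : Levellised C) where
  open NLattice C nl public

  k : ℕ
  k = dep C lastF

  toℕ-lastF : toℕ (lastF {suc (suc m)}) ≡ suc (suc m)
  toℕ-lastF = toℕ-fromℕ _

  k≥1 : 1 ≤ k
  k≥1 = ≤-trans (≤-reflexive (cong suc (sym dep-top))) (dep-strict (strict-top lastF (λ ())))

  dep≤k : ∀ x → 0 < toℕ x → dep C x ≤ k
  dep≤k x pos = lv x lastF pos (subst (toℕ x ≤_) (sym toℕ-lastF) (toℕ≤pred[n] x))

  k<dep𝟎 : k < dep C 𝟎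
  k<dep𝟎 = dep-strict (strict-bot lastF (λ ()))

  inPrime⇒< : ∀ x → 0 < toℕ x → inPrime C x ≡ true → dep C x < k
  inPrime⇒< x pos e = ≤∧≢⇒< (dep≤k x pos) (λ eq → true≢false (≡⇒≡ᵇ′ _ _ eq) (not-true e))

  <⇒inPrime : ∀ x → dep C x < k → inPrime C x ≡ true
  <⇒inPrime x lt = not-false (≢⇒≡ᵇfalse _ _ (<⇒≢ lt))

  inPrime-𝟎 : inPrime C 𝟎 ≡ true
  inPrime-𝟎 = not-false (≢⇒≡ᵇfalse _ _ (>⇒≢ k<dep𝟎))

  inPrime-segment : InitialSegment (inPrime C)
  inPrime-segment fzero    j _  _  = inPrime-𝟎
  inPrime-segment (fsuc i) j pj le = <⇒inPrime (fsuc i)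
    (≤-<-trans (lv (fsuc i) j (s≤s z≤n) le) (inPrime⇒< j (≤-trans (s≤s z≤n) le) pj))

  prime-below : ∀ x → inPrime C x ≡ true → toℕ x < primeSize C
  prime-below x e = subst (toℕ x <_) (sym (primeSize≡count C)) (segment-below (inPrime C) inPrime-segment x e)

  prime-member : ∀ x → toℕ x < primeSize C → inPrime C x ≡ true
  prime-member x lt = segment-member (inPrime C) inPrime-segment x (subst (toℕ x <_) (primeSize≡count C) lt)

  prime-dep< : ∀ x → 0 < toℕ x → toℕ x < primeSize C → dep C x < k
  prime-dep< x pos lt = inPrime⇒< x pos (prime-member x lt)

  last-level : ∀ x → primeSize C ≤ toℕ x → 0 < toℕ x × dep C x ≡ k
  last-level fzero    le = ⊥-elim (<-irrefl refl (≤-<-trans le (prime-below fzero inPrime-𝟎)))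
  last-level (fsuc x) le = s≤s z≤n ,
    ≡ᵇ⇒≡′ _ _ (not-injective (¬-not (λ e → <-irrefl refl (≤-<-trans le (prime-below (fsuc x) e)))))

  -- 2 ≤ a < n: L′ contains 0 and 1, but not the last label.
  2≤primeSize : 2 ≤ primeSize C
  2≤primeSize = prime-below 𝟏 (<⇒inPrime 𝟏 (subst (_< k) (sym dep-top) k≥1))

  primeSize<n : primeSize C ≤ suc (suc m)
  primeSize<n = ≮⇒≥ (λ lt → true≢false (prime-member lastF (subst (_< primeSize C) (sym toℕ-lastF) lt))
                                          (cong not (≡⇒≡ᵇ′ k k refl)))

  not-below-last-level : ∀ x y → 0 < toℕ x → dep C x < k → dep C y ≡ k → C x y ≡ false
  not-below-last-level x y pos dx dy = ¬-not below
    where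
    below : ¬ (C x y ≡ true)
    below r with ≤⇒≡⊎strict r
    ... | inj₁ refl = <-irrefl dy dx
    ... | inj₂ s    = <-irrefl refl (<-trans (≤-trans (≤-reflexive (cong suc (sym dy))) (dep-strict s)) dx)

  last-level-covers : ∀ j c → dep C j ≡ k → covers C j c ≡ true → 0 < toℕ c × dep C c < k
  last-level-covers j fzero    dj cv = ⊥-elim (nothing-below-bot j (covers⇒strict cv))
  last-level-covers j (fsuc c) dj cv = s≤s z≤n , ≤-trans (dep-strict (covers⇒strict cv)) (≤-reflexive dj)

module Prime {m} (C : BRel (suc (suc (suc m)))) (nl : IsNLattice C) (lv : Levellised C)
             (m′ : ℕ) (a≡ : primeSize C ≡ suc (suc m′)) where
  open LevelStructure C nl lv public

  a : ℕ
  a = suc (suc m′)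

  p : a ≤ suc (suc (suc m))
  p = ≤-trans (≤-reflexive (sym a≡)) (≤-trans primeSize<n (n≤1+n _))

  C′ : BRel a
  C′ = restrict p C

  ι : Fin a → Fin (suc (suc (suc m)))
  ι i = inject≤ i p

  toℕ-ι : ∀ i → toℕ (ι i) ≡ toℕ i
  toℕ-ι i = toℕ-inject≤ i p

  ι<a : ∀ i → toℕ (ι i) < primeSize C
  ι<a i = subst₂ _<_ (sym (toℕ-ι i)) (sym a≡) (toℕ<n i)

  ι-injective : ∀ {i j} → ι i ≡ ι j → i ≡ j
  ι-injective {i} {j} = inject≤-injective p p i j

  lift : ∀ (x : Fin (suc (suc (suc m)))) → toℕ x < a → Fin a
  lift x lt = fromℕ< lt

  ι-lift : ∀ (x : Fin (suc (suc (suc m)))) (lt : toℕ x < a) → ι (lift x lt) ≡ x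
  ι-lift x lt = toℕ-injective (trans (toℕ-ι _) (toℕ-fromℕ< lt))

  ≥a⇒≥primeSize : ∀ (z : Fin (suc (suc (suc m)))) → ¬ (toℕ z < a) → primeSize C ≤ toℕ z
  ≥a⇒≥primeSize z nlt = subst (_≤ toℕ z) (sym a≡) (≮⇒≥ nlt)

  below-last-level⇒𝟎 : ∀ (x z : Fin (suc (suc (suc m)))) →
                       toℕ x < primeSize C → C x z ≡ true → primeSize C ≤ toℕ z → x ≡ 𝟎
  below-last-level⇒𝟎 fzero    z lt r le = refl
  below-last-level⇒𝟎 (fsuc x) z lt r le = ⊥-elim (true≢false r
    (not-below-last-level (fsuc x) z (s≤s z≤n) (prime-dep< (fsuc x) (s≤s z≤n) lt) (proj₂ (last-level z le))))

  prime-partialOrder : IsPartialOrder C′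
  prime-partialOrder = (λ i → R-refl (ι i)) , (λ i j r s → ι-injective (R-antisym _ _ r s)) , (λ i j l r s → R-trans _ _ _ r s)

  -- Joins: the join in C of two elements of L′ lies in L′, since a last-level
  -- upper bound of x and y forces x = y = 0.
  join-in-prime : ∀ x y → Join C (ι x) (ι y) → Join C′ x y
  join-in-prime x y (z , (u₁ , u₂) , least) = inside (toℕ z <? a)
    where
    inside : Dec (toℕ z < a) → Join C′ x y
    inside (yes lt) = lift z lt ,
      (subst (λ w → C (ι x) w ≡ true) (sym (ι-lift z lt)) u₁ , subst (λ w → C (ι y) w ≡ true) (sym (ι-lift z lt)) u₂) ,
      (λ d ub → subst (λ w → C w (ι d) ≡ true) (sym (ι-lift z lt)) (least (ι d) ub))
    inside (no nlt) = ⊥-elim (nlt (subst (λ w → toℕ w < a) (sym z≡𝟎) (s≤s z≤n)))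
      where
      x≡𝟎 : ι x ≡ 𝟎
      x≡𝟎 = below-last-level⇒𝟎 (ι x) z (ι<a x) u₁ (≥a⇒≥primeSize z nlt)
      y≡𝟎 : ι y ≡ 𝟎
      y≡𝟎 = below-last-level⇒𝟎 (ι y) z (ι<a y) u₂ (≥a⇒≥primeSize z nlt)
      z≡𝟎 : z ≡ 𝟎
      z≡𝟎 = R-antisym z 𝟎 (least 𝟎 (subst (λ w → C w 𝟎 ≡ true) (sym x≡𝟎) (R-refl 𝟎) ,
                                    subst (λ w → C w 𝟎 ≡ true) (sym y≡𝟎) (R-refl 𝟎))) (bot z)

  -- Meets: if the meet in C lies in the last level, every common lower bound
  -- in L′ is 0, so 0 is the meet in L′.
  meet-in-prime : ∀ x y → Meet C (ι x) (ι y) → Meet C′ x y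
  meet-in-prime x y (z , (l₁ , l₂) , great) = inside (toℕ z <? a)
    where
    inside : Dec (toℕ z < a) → Meet C′ x y
    inside (yes lt) = lift z lt ,
      (subst (λ w → C w (ι x) ≡ true) (sym (ι-lift z lt)) l₁ , subst (λ w → C w (ι y) ≡ true) (sym (ι-lift z lt)) l₂) ,
      (λ d lb → subst (λ w → C (ι d) w ≡ true) (sym (ι-lift z lt)) (great (ι d) lb))
    inside (no nlt) = 𝟎 , (bot (ι x) , bot (ι y)) ,
      (λ d lb → subst (λ w → C w 𝟎 ≡ true)
                  (sym (below-last-level⇒𝟎 (ι d) z (ι<a d) (great (ι d) lb) (≥a⇒≥primeSize z nlt))) (R-refl 𝟎))

  prime-nLattice : IsNLattice C′
  prime-nLattice = (prime-partialOrder , (λ x y → join-in-prime x y (proj₁ (proj₂ (proj₁ nl)) (ι x) (ι y))) ,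
                    (λ x y → meet-in-prime x y (proj₂ (proj₂ (proj₁ nl)) (ι x) (ι y)))) ,
                    (λ x → bot (ι x)) , (λ x → top (ι x))

  -- Everything strictly above a nonzero element of L′ is in L′, so depths
  -- computed in L′ and in C agree there.
  Closed : Fin (suc (suc (suc m))) → Set
  Closed x = ∀ y → strict C x y ≡ true → toℕ y < a

  -- Nonzero labels of L′ are closed upwards within L′, since depth decreases.
  nonzero-closed : ∀ i → 0 < toℕ i → Closed (ι i)
  nonzero-closed i pos fzero    s = ⊥-elim (nothing-below-bot (ι i) s)
  nonzero-closed i pos (fsuc y) s = subst (toℕ (fsuc y) <_) a≡ (prime-below (fsuc y) (<⇒inPrime (fsuc y)
    (<-trans (dep-strict s) (prime-dep< (ι i) (subst (0 <_) (sym (toℕ-ι i)) pos) (ι<a i)))))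

  strict-ι : ∀ i b → strict C′ i b ≡ strict C (ι i) (ι b)
  strict-ι i b = cong (λ v → C (ι i) (ι b) ∧ not v) (≟-ι (i ≟ b))
    where
    ≟-ι : Dec (i ≡ b) → does (i ≟ b) ≡ does (ι i ≟ ι b)
    ≟-ι (yes refl) = trans (dec-true (i ≟ i) refl) (sym (dec-true (ι i ≟ ι i) refl))
    ≟-ι (no ne)    = trans (dec-false (i ≟ b) ne) (sym (dec-false (ι i ≟ ι b) (ne ∘ ι-injective)))

  depthF-ι : ∀ f i → Closed (ι i) → depthF f C′ i ≡ depthF f C (ι i)
  depthF-ι zero    i cl = refl
  depthF-ι (suc f) i cl = ≤-antisym
    (maxOver-lub (strict C′ i) _ _ (λ b s → let s′ = trans (sym (strict-ι i b)) s in
      ≤-trans (≤-reflexive (cong suc (depthF-ι f b (λ y → cl y ∘ strict-trans s′))))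
              (maxOver-ub (strict C (ι i)) (λ b → suc (depthF f C b)) (ι b) s′)))
    (maxOver-lub (strict C (ι i)) _ _ (λ y s → lifted y s (cl y s)))
    where
    lifted : ∀ y → strict C (ι i) y ≡ true → (lt : toℕ y < a) →
             suc (depthF f C y) ≤ maxOver (strict C′ i) (λ b → suc (depthF f C′ b))
    lifted y s lt = ≤-trans
      (≤-reflexive (cong suc (trans (cong (depthF f C) (sym (ι-lift y lt)))
                                    (sym (depthF-ι f (lift y lt) (λ y′ → cl y′ ∘ strict-trans s′))))))
      (maxOver-ub (strict C′ i) (λ b → suc (depthF f C′ b)) (lift y lt) (trans (strict-ι i (lift y lt)) s′))
      where
      s′ : strict C (ι i) (ι (lift y lt)) ≡ true
      s′ = subst (λ w → strict C (ι i) w ≡ true) (sym (ι-lift y lt)) s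

  dep-ι : ∀ i → 0 < toℕ i → dep C′ i ≡ dep C (ι i)
  dep-ι i pos = trans (sym (PartialOrder.dep-fuel C′ prime-partialOrder (suc (suc (suc m))) i p))
                      (depthF-ι (suc (suc (suc m))) i (nonzero-closed i pos))

  prime-levellised : Levellised C′
  prime-levellised i j pos le = subst₂ _≤_ (sym (dep-ι i pos)) (sym (dep-ι j (≤-trans pos le)))
    (lv (ι i) (ι j) (subst (0 <_) (sym (toℕ-ι i)) pos) (subst₂ _≤_ (sym (toℕ-ι i)) (sym (toℕ-ι j)) le))

-- Isomorphic levellised n-lattices have the same depth at every nonzero
-- label: for each t, the labels of depth ≤ t together with 0 form an initial
-- segment whose size is an isomorphism invariant.

SameDepths : ∀ {n} → BRel n → BRel n → Set
SameDepths {n} C D = ∀ (i : Fin n) → 0 < toℕ i → dep C i ≡ dep D i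

isZero : ∀ {n} → Fin n → Bool
isZero fzero    = true
isZero (fsuc _) = false

depthAtMost : ∀ {n} → BRel n → ℕ → Fin n → Bool
depthAtMost R t i = isZero i ∨ does (dep R i ≤? t)

depthAtMost-segment : ∀ {m} (R : BRel (suc (suc m))) → Levellised R → ∀ t → InitialSegment (depthAtMost R t)
depthAtMost-segment R lv t fzero    j        _  _  = refl
depthAtMost-segment R lv t (fsuc i) (fsuc j) pj le =
  dec-true (dep R (fsuc i) ≤? t) (≤-trans (lv (fsuc i) (fsuc j) (s≤s z≤n) le) (does⇒ (dep R (fsuc j) ≤? t) pj))

iso⇒sameDepths : ∀ {m} (C D : BRel (suc (suc m))) → IsNLattice C → Levellised C →
                 IsNLattice D → Levellised D → Iso C D → SameDepths C D
iso⇒sameDepths C D nlC lvC nlD lvD (π , p) (fsuc i) _ =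
  ≤-antisym (atMost (dep D (fsuc i)) ≤-refl) (atMost′ (dep C (fsuc i)) ≤-refl)
  where
  σ τ : Fin _ → Fin _
  σ = π ⟨$⟩ʳ_
  τ = π ⟨$⟩ˡ_

  -- The isomorphism σ preserves depth, and fixes 0 since it preserves the bottom.
  dep-σ : ∀ j → dep C j ≡ dep D (σ j)
  dep-σ = Relabel.dep-relabel C D σ τ (λ _ → inverseˡ π) (λ _ → inverseʳ π) p

  σ𝟎 : σ 𝟎 ≡ 𝟎
  σ𝟎 = NLattice.R-antisym D nlD (σ 𝟎) 𝟎
         (trans (sym (cong (D (σ 𝟎)) (inverseʳ π))) (trans (sym (p 𝟎 (τ 𝟎))) (NLattice.bot C nlC (τ 𝟎))))
         (NLattice.bot D nlD (σ 𝟎))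

  isZero-σ : ∀ j → isZero j ≡ isZero (σ j)
  isZero-σ fzero = cong isZero (sym σ𝟎)
  isZero-σ (fsuc j) with σ (fsuc j) in e
  ... | fsuc _ = refl
  ... | fzero with () ← trans (sym (inverseˡ π)) (trans (cong τ (trans e (sym σ𝟎))) (inverseˡ π))

  -- Each `depthAtMost R t` has an isomorphism-invariant count, so the two
  -- initial segments coincide.
  same-segment : ∀ t j → depthAtMost C t j ≡ depthAtMost D t j
  same-segment t = segment-unique (depthAtMost C t) (depthAtMost D t)
    (depthAtMost-segment C lvC t) (depthAtMost-segment D lvD t)
    (trans (count-cong _ _ (λ j → cong₂ _∨_ (isZero-σ j) (cong (λ d → does (d ≤? t)) (dep-σ j))))
           (count-permute (depthAtMost D t) π))

  atMost : ∀ t → dep D (fsuc i) ≤ t → dep C (fsuc i) ≤ t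
  atMost t le = does⇒ (dep C (fsuc i) ≤? t) (trans (same-segment t (fsuc i)) (dec-true (dep D (fsuc i) ≤? t) le))

  atMost′ : ∀ t → dep C (fsuc i) ≤ t → dep D (fsuc i) ≤ t
  atMost′ t le = does⇒ (dep D (fsuc i) ≤? t) (trans (sym (same-segment t (fsuc i))) (dec-true (dep C (fsuc i) ≤? t) le))

-- Reconstruction: a levellised n-lattice C is determined by L′, its depths,
-- and the weights wt(cov^d(j)) of its last-level elements j at the levels
-- 1 ≤ d < k.  The weights determine the covers of j inside L′, the top is
-- covered exactly by the elements of depth 1, and every strict upper bound
-- of j is above one of its covers.

wtCov≡weight : ∀ {n} (R : BRel n) d j → wtCov R d j ≡ weight (λ c → covers R j c ∧ (dep R c ≡ᵇ d))
wtCov≡weight R d j = sum-map-allFin (λ c → if covers R j c ∧ (dep R c ≡ᵇ d) then 2 ^ toℕ c else 0)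

module UpperBounds {m} (X Y : BRel (suc (suc (suc m))))
  (nlX : IsNLattice X) (lvX : Levellised X) (poY : IsPartialOrder Y)
  (a : ℕ) (aX : primeSize X ≡ a)
  (agree : ∀ x y → toℕ x < a → toℕ y < a → X x y ≡ Y x y)
  (same-covers : ∀ j → a ≤ toℕ j → ∀ c → covers X j c ≡ covers Y j c) where
  module LX = LevelStructure X nlX lvX
  module PY = PartialOrder Y poY

  -- A strict X-upper bound y of x lies above an X-cover c of x; c is a
  -- Y-cover too and lies in L′, so either y is in L′ and c ≤ y in Y, or y is
  -- in the last level, which no nonzero element of L′ lies below.
  upper-bound : ∀ x y → a ≤ toℕ x → X x y ≡ true → Y x y ≡ true
  upper-bound x y ax r with LX.≤⇒≡⊎strict r
  ... | inj₁ refl = PY.R-refl x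
  ... | inj₂ s with c , cv , c≤y ← LX.cover-below x y s
               with c>0 , c<k ← LX.last-level-covers x c (proj₂ (LX.last-level x (subst (_≤ toℕ x) (sym aX) ax))) cv
               with toℕ y <? a
  ...   | yes y<a = PY.R-trans x c y (strict⇒≤ Y (PY.covers⇒strict (trans (sym (same-covers x ax c)) cv)))
                                     (trans (sym (agree c y c<a y<a)) c≤y)
    where
    c<a : toℕ c < a
    c<a = subst (toℕ c <_) aX (LX.prime-below c (LX.<⇒inPrime c c<k))
  ...   | no y≮a = ⊥-elim (true≢false c≤y (LX.not-below-last-level c y c>0 c<k
                     (proj₂ (LX.last-level y (subst (_≤ toℕ y) (sym aX) (≮⇒≥ y≮a))))))

module Reconstruct {m} (C D : BRel (suc (suc (suc m))))
  (nlC : IsNLattice C) (lvC : Levellised C) (nlD : IsNLattice D) (lvD : Levellised D)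
  (sd : SameDepths C D) (a : ℕ) (aC : primeSize C ≡ a) (aD : primeSize D ≡ a)
  (agree : ∀ x y → toℕ x < a → toℕ y < a → C x y ≡ D x y)
  (weights : ∀ d → 1 ≤ d → d < dep C lastF → ∀ j → a ≤ toℕ j → wtCov C d j ≡ wtCov D d j) where
  module LC = LevelStructure C nlC lvC
  module LD = LevelStructure D nlD lvD

  last-levelC : ∀ (j : Fin (suc (suc (suc m)))) → a ≤ toℕ j → 0 < toℕ j × dep C j ≡ LC.k
  last-levelC j aj = LC.last-level j (subst (_≤ toℕ j) (sym aC) aj)

  last-levelD : ∀ (j : Fin (suc (suc (suc m)))) → a ≤ toℕ j → 0 < toℕ j × dep D j ≡ LD.k
  last-levelD j aj = LD.last-level j (subst (_≤ toℕ j) (sym aD) aj)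

  -- A cover c ≠ 1 of depth d = dep c < k is recorded in bit c of wt(cov^d(j)).
  covers-from-weights : ∀ j → a ≤ toℕ j → ∀ c → 0 < toℕ c → c ≢ 𝟏 → dep C c < LC.k →
                        covers C j c ≡ covers D j c
  covers-from-weights j aj c c>0 c≢1 c<k = begin
    covers C j c                      ≡⟨ ∧-identityʳ _ ⟨
    covers C j c ∧ true               ≡⟨ cong (covers C j c ∧_) (≡⇒≡ᵇ′ d d refl) ⟨
    covers C j c ∧ (dep C c ≡ᵇ d)     ≡⟨ weight-injective (coversAt C) (coversAt D) same-weight c ⟩
    covers D j c ∧ (dep D c ≡ᵇ d)     ≡⟨ cong (λ e → covers D j c ∧ (e ≡ᵇ d)) (sym (sd c c>0)) ⟩
    covers D j c ∧ (d ≡ᵇ d)           ≡⟨ cong (covers D j c ∧_) (≡⇒≡ᵇ′ d d refl) ⟩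
    covers D j c ∧ true               ≡⟨ ∧-identityʳ _ ⟩
    covers D j c                      ∎
    where
    open ≡-Reasoning
    d : ℕ
    d = dep C c
    coversAt : BRel (suc (suc (suc m))) → Fin (suc (suc (suc m))) → Bool
    coversAt R c = covers R j c ∧ (dep R c ≡ᵇ d)
    same-weight : weight (coversAt C) ≡ weight (coversAt D)
    same-weight = trans (sym (wtCov≡weight C d j))
      (trans (weights d (n≢0⇒n>0 (c≢1 ∘ LC.dep≡0⇒top c)) c<k j aj) (wtCov≡weight D d j))

  -- The last-level elements have the same covers in C and D: no cover is 0,
  -- covering 1 means depth 1, and the other covers are recorded in the weights.
  same-covers : ∀ j → a ≤ toℕ j → ∀ c → covers C j c ≡ covers D j c
  same-covers j aj fzero = trans (¬-not (LC.nothing-below-bot j ∘ LC.covers⇒strict))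
                                 (sym (¬-not (LD.nothing-below-bot j ∘ LD.covers⇒strict)))
  same-covers j aj (fsuc c) with fsuc c ≟ 𝟏 | dep C (fsuc c) <? LC.k
  ... | yes refl | _ = trans (LC.covers-top j) (trans (cong (_≡ᵇ 1) (sd j (proj₁ (last-levelC j aj)))) (sym (LD.covers-top j)))
  ... | no c≢1 | yes c<k = covers-from-weights j aj (fsuc c) (s≤s z≤n) c≢1 c<k
  ... | no _   | no c≮k = trans (¬-not (c≮k ∘ proj₂ ∘ LC.last-level-covers j (fsuc c) (proj₂ (last-levelC j aj))))
                                (sym (¬-not (c≮k ∘ subst₂ _<_ (sym (sd (fsuc c) (s≤s z≤n))) (sym k≡)
                                  ∘ proj₂ ∘ LD.last-level-covers j (fsuc c) (proj₂ (last-levelD j aj)))))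
    where
    k≡ : LC.k ≡ LD.k
    k≡ = sd lastF (s≤s z≤n)

  -- Below a, a nonzero label is in L′ and so below no last-level element.
  below-a : ∀ x y → toℕ x < a → ¬ (toℕ y < a) → C x y ≡ D x y
  below-a fzero    y x<a y≮a = trans (LC.bot y) (sym (LD.bot y))
  below-a (fsuc x) y x<a y≮a =
    trans (LC.not-below-last-level (fsuc x) y (s≤s z≤n) (LC.prime-dep< (fsuc x) (s≤s z≤n) (subst (_ <_) (sym aC) x<a))
                                   (proj₂ (last-levelC y (≮⇒≥ y≮a))))
    (sym (LD.not-below-last-level (fsuc x) y (s≤s z≤n) (LD.prime-dep< (fsuc x) (s≤s z≤n) (subst (_ <_) (sym aD) x<a))
                                  (proj₂ (last-levelD y (≮⇒≥ y≮a)))))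

  -- C and D coincide: below a by hypothesis, between L′ and the last level
  -- by depth, and above last-level elements via their covers.
  reconstruct : C ≐ D
  reconstruct x y with toℕ x <? a | toℕ y <? a
  ... | yes x<a | yes y<a = agree x y x<a y<a
  ... | yes x<a | no y≮a  = below-a x y x<a y≮a
  ... | no x≮a  | _       = bool-ext
    (UpperBounds.upper-bound C D nlC lvC (proj₁ (proj₁ nlD)) a aC agree same-covers x y (≮⇒≥ x≮a))
    (UpperBounds.upper-bound D C nlD lvD (proj₁ (proj₁ nlC)) a aD (λ u v u<a v<a → sym (agree u v u<a v<a))
                             (λ j aj c → sym (same-covers j aj c)) x y (≮⇒≥ x≮a))

-- Two weight tables w₁ w₂ : ℕ → Fin n → ℕ are compared
-- on the labels ≥ a at the levels 1 ≤ d < K, scanning the levels downwards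
-- and, within a level, the labels upwards; either they agree, or there is a
-- first position where they differ -- exactly the data of a `level<` witness.

AgreeBelow : ∀ {n} (w₁ w₂ : ℕ → Fin n → ℕ) (a K : ℕ) → Set
AgreeBelow w₁ w₂ a K = ∀ d → 1 ≤ d → d < K → ∀ j → a ≤ toℕ j → w₁ d j ≡ w₂ d j

record FirstDifference {n} (w₁ w₂ : ℕ → Fin n → ℕ) (a K : ℕ) : Set where
  field
    ℓ      : ℕ
    i      : Fin n
    1≤ℓ    : 1 ≤ ℓ
    ℓ<K    : ℓ < K
    a≤i    : a ≤ toℕ i
    above  : ∀ d j → ℓ < d → d < K → a ≤ toℕ j → w₁ d j ≡ w₂ d j
    before : ∀ j → a ≤ toℕ j → toℕ j < toℕ i → w₁ ℓ j ≡ w₂ ℓ j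
    differ : w₁ ℓ i ≢ w₂ ℓ i

least-failure : ∀ {n} (Q : Fin n → Set) → (∀ i → Dec (Q i)) →
                (∀ i → Q i) ⊎ (∃ λ i → ¬ Q i × (∀ j → toℕ j < toℕ i → Q j))
least-failure {zero}  Q Q? = inj₁ (λ ())
least-failure {suc n} Q Q? with Q? fzero
... | no ¬q₀ = inj₂ (fzero , ¬q₀ , λ j ())
... | yes q₀ with least-failure (Q ∘ fsuc) (Q? ∘ fsuc)
...   | inj₁ all = inj₁ (λ { fzero → q₀ ; (fsuc j) → all j })
...   | inj₂ (i , ¬q , below) = inj₂ (fsuc i , ¬q , λ { fzero _ → q₀ ; (fsuc j) (s≤s lt) → below j lt })

-- Extending a comparison from the levels below K+1 to those below K+2: a
-- difference at level K+1 takes precedence over any lower one.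
LevelScan : ∀ {n} (w₁ w₂ : ℕ → Fin n → ℕ) (a d : ℕ) → Set
LevelScan w₁ w₂ a d = (∀ j → a ≤ toℕ j → w₁ d j ≡ w₂ d j) ⊎
                      (∃ λ i → ¬ (a ≤ toℕ i → w₁ d i ≡ w₂ d i) ×
                               (∀ j → toℕ j < toℕ i → a ≤ toℕ j → w₁ d j ≡ w₂ d j))

scan-level : ∀ {n} (w₁ w₂ : ℕ → Fin n → ℕ) a d → LevelScan w₁ w₂ a d
scan-level w₁ w₂ a d =
  least-failure (λ j → a ≤ toℕ j → w₁ d j ≡ w₂ d j) (λ j → a ≤? toℕ j →-dec (w₁ d j ≟ℕ w₂ d j))

difference-step : ∀ {n} (w₁ w₂ : ℕ → Fin n → ℕ) a K → LevelScan w₁ w₂ a (suc K) →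
                  AgreeBelow w₁ w₂ a (suc K) ⊎ FirstDifference w₁ w₂ a (suc K) →
                  AgreeBelow w₁ w₂ a (suc (suc K)) ⊎ FirstDifference w₁ w₂ a (suc (suc K))
difference-step w₁ w₂ a K (inj₂ (i , ¬q , below)) _ = inj₂ record
  { ℓ = suc K ; i = i ; 1≤ℓ = s≤s z≤n ; ℓ<K = ≤-refl ; a≤i = a≤i
  ; above = λ d j ℓ<d d<K _ → ⊥-elim (<-irrefl refl (≤-trans d<K ℓ<d))
  ; before = λ j aj j<i → below j j<i aj
  ; differ = λ e → ¬q (λ _ → e) }
  where
  a≤i : a ≤ toℕ i
  a≤i with a ≤? toℕ i
  ... | yes le = le
  ... | no ¬le = ⊥-elim (¬q (λ le → ⊥-elim (¬le le)))
difference-step w₁ w₂ a K (inj₁ top-level) (inj₁ agree) = inj₁ λ d 1≤d d<K j aj →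
  [ (λ d<K′ → agree d 1≤d d<K′ j aj) , (λ { refl → top-level j aj }) ]′ (m≤n⇒m<n∨m≡n (≤-pred d<K))
difference-step w₁ w₂ a K (inj₁ top-level) (inj₂ diff) = inj₂ record
  { ℓ = ℓ ; i = i ; 1≤ℓ = 1≤ℓ ; ℓ<K = ≤-trans ℓ<K (n≤1+n _) ; a≤i = a≤i
  ; above = λ d j ℓ<d d<K aj →
      [ (λ d<K′ → above d j ℓ<d d<K′ aj) , (λ { refl → top-level j aj }) ]′ (m≤n⇒m<n∨m≡n (≤-pred d<K))
  ; before = before ; differ = differ }
  where open FirstDifference diff

first-difference : ∀ {n} (w₁ w₂ : ℕ → Fin n → ℕ) a K → AgreeBelow w₁ w₂ a K ⊎ FirstDifference w₁ w₂ a K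
first-difference w₁ w₂ a zero          = inj₁ (λ d _ ())
first-difference w₁ w₂ a (suc zero)    = inj₁ (λ { (suc d) _ (s≤s ()) })
first-difference w₁ w₂ a (suc (suc K)) =
  difference-step w₁ w₂ a K (scan-level w₁ w₂ a (suc K)) (first-difference w₁ w₂ a (suc K))

Trichotomy : ∀ {n} → BRel n → BRel n → Set
Trichotomy C D = C ≐ D ⊎ C ≺ D ⊎ D ≺ C

TrichotomyAt : ℕ → Set
TrichotomyAt m = ∀ (C D : BRel (suc (suc m))) → IsNLattice C → Levellised C →
                 IsNLattice D → Levellised D → SameDepths C D → Trichotomy C D

-- A 2-lattice is the chain 0 < 1.
two-lattices-equal : (C D : BRel 2) → IsNLattice C → IsNLattice D → C ≐ D
two-lattices-equal C D nlC nlD fzero        j            = trans (NLattice.bot C nlC j) (sym (NLattice.bot D nlD j))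
two-lattices-equal C D nlC nlD (fsuc fzero) (fsuc fzero) = trans (NLattice.top C nlC 𝟏) (sym (NLattice.top D nlD 𝟏))
two-lattices-equal C D nlC nlD (fsuc fzero) fzero        = trans (1≰0 C nlC) (sym (1≰0 D nlD))
  where
  1≰0 : ∀ R → IsNLattice R → R 𝟏 𝟎 ≡ false
  1≰0 R nl = ¬-not (λ r → case (NLattice.R-antisym R nl 𝟏 𝟎 r (NLattice.bot R nl 𝟏)))
    where
    case : 𝟏 {0} ≢ 𝟎
    case ()

-- Last-level elements have no covers of depth ≥ k, so their weights there vanish.
deep-weights-vanish : ∀ {m} (C : BRel (suc (suc (suc m)))) → IsNLattice C → Levellised C →
                      ∀ d j → dep C lastF ≤ d → dep C j ≡ dep C lastF → wtCov C d j ≡ 0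
deep-weights-vanish {m} C nl lv d j k≤d dj = begin
  wtCov C d j    ≡⟨ sum-map-allFin term ⟩
  ∑ term         ≡⟨ sum-cong-≗ term≡0 ⟩
  ∑ {suc (suc (suc m))} (λ _ → 0) ≡⟨ sum-replicate-zero (suc (suc (suc m))) ⟩
  0              ∎
  where
  open ≡-Reasoning
  open LevelStructure C nl lv using (last-level-covers)
  term : Fin (suc (suc (suc m))) → ℕ
  term c = if covers C j c ∧ (dep C c ≡ᵇ d) then 2 ^ toℕ c else 0
  term≡0 : ∀ c → term c ≡ 0
  term≡0 c with covers C j c in cv
  ... | false = refl
  ... | true rewrite ≢⇒≡ᵇfalse (dep C c) d (<⇒≢ (<-≤-trans (proj₂ (last-level-covers j c dj cv)) k≤d)) = refl

module TrichotomyStep {m} (C D : BRel (suc (suc (suc m))))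
  (nlC : IsNLattice C) (lvC : Levellised C) (nlD : IsNLattice D) (lvD : Levellised D)
  (sd : SameDepths C D) (m′ : ℕ) (aC : primeSize C ≡ suc (suc m′)) where
  module LC = LevelStructure C nlC lvC
  module LD = LevelStructure D nlD lvD

  k≡ : dep C lastF ≡ dep D lastF
  k≡ = sd lastF (s≤s z≤n)

  same-inPrime : ∀ i → inPrime C i ≡ inPrime D i
  same-inPrime fzero    = trans LC.inPrime-𝟎 (sym LD.inPrime-𝟎)
  same-inPrime (fsuc i) = cong₂ (λ u v → not (u ≡ᵇ v)) (sd (fsuc i) (s≤s z≤n)) k≡

  aD : primeSize D ≡ suc (suc m′)
  aD = trans (primeSize≡count D) (trans (sym (count-cong _ _ same-inPrime)) (trans (sym (primeSize≡count C)) aC))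

  module PC = Prime C nlC lvC m′ aC
  module PD = Prime D nlD lvD m′ aD

  a : ℕ
  a = suc (suc m′)

  m′<m : m′ < suc m
  m′<m = s≤s (≤-pred (≤-pred (subst (_≤ suc (suc m)) aC LC.primeSize<n)))

  prime-sameDepths : SameDepths PC.C′ PD.C′
  prime-sameDepths i pos =
    trans (PC.dep-ι i pos) (trans (sd (PC.ι i) (subst (0 <_) (sym (PC.toℕ-ι i)) pos)) (sym (PD.dep-ι i pos)))

  agree-below : PC.C′ ≐ PD.C′ → ∀ x y → toℕ x < a → toℕ y < a → C x y ≡ D x y
  agree-below E x y x<a y<a =
    subst₂ (λ u v → C u v ≡ D u v) (PC.ι-lift x x<a) (PC.ι-lift y y<a) (E (PC.lift x x<a) (PC.lift y y<a))

  extend-above : ∀ ℓ → (∀ d j → ℓ < d → d < dep C lastF → a ≤ toℕ j → wtCov C d j ≡ wtCov D d j) →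
                 ∀ d j → ℓ < d → a ≤ toℕ j → wtCov C d j ≡ wtCov D d j
  extend-above ℓ above d j ℓ<d aj with d <? dep C lastF
  ... | yes d<k = above d j ℓ<d d<k aj
  ... | no d≮k  = trans
    (deep-weights-vanish C nlC lvC d j (≮⇒≥ d≮k) (proj₂ (LC.last-level j (subst (_≤ toℕ j) (sym aC) aj))))
    (sym (deep-weights-vanish D nlD lvD d j (subst (_≤ d) k≡ (≮⇒≥ d≮k))
                                             (proj₂ (LD.last-level j (subst (_≤ toℕ j) (sym aD) aj)))))

  from-difference : PC.C′ ≐ PD.C′ → FirstDifference (wtCov C) (wtCov D) a (dep C lastF) → Trichotomy C D
  from-difference E diff = by-cmp (<-cmp (wtCov C ℓ i) (wtCov D ℓ i))
    where
    open FirstDifference diff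
    by-cmp : Tri (wtCov C ℓ i < wtCov D ℓ i) (wtCov C ℓ i ≡ wtCov D ℓ i) (wtCov D ℓ i < wtCov C ℓ i) → Trichotomy C D
    by-cmp (tri< lt _ _) = inj₂ (inj₁ (level< a PC.p aC aD E (dep C lastF) refl (sym k≡)
      ℓ 1≤ℓ ℓ<K i a≤i (extend-above ℓ above) before lt))
    by-cmp (tri≈ _ e _)  = ⊥-elim (differ e)
    by-cmp (tri> _ _ gt) = inj₂ (inj₂ (level< a PD.p aD aC (≐-sym E) (dep C lastF) (sym k≡) refl
      ℓ 1≤ℓ ℓ<K i a≤i (λ d j ℓ<d aj → sym (extend-above ℓ above d j ℓ<d aj)) (λ j aj j<i → sym (before j aj j<i)) gt))

  compare-last-levels : PC.C′ ≐ PD.C′ →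
                        AgreeBelow (wtCov C) (wtCov D) a (dep C lastF) ⊎ FirstDifference (wtCov C) (wtCov D) a (dep C lastF) →
                        Trichotomy C D
  compare-last-levels E (inj₁ agree) = inj₁ (Reconstruct.reconstruct C D nlC lvC nlD lvD sd a aC aD (agree-below E) agree)
  compare-last-levels E (inj₂ diff)  = from-difference E diff

  compare : Trichotomy PC.C′ PD.C′ → Trichotomy C D
  compare (inj₁ E)         = compare-last-levels E (first-difference (wtCov C) (wtCov D) a (dep C lastF))
  compare (inj₂ (inj₁ lt)) = inj₂ (inj₁ (prime< a PC.p aC aD lt))
  compare (inj₂ (inj₂ gt)) = inj₂ (inj₂ (prime< a PD.p aD aC gt))

  step : TrichotomyAt m′ → Trichotomy C D
  step ih = compare (ih PC.C′ PD.C′ PC.prime-nLattice PC.prime-levellised PD.prime-nLattice PD.prime-levellised prime-sameDepths)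

two-plus : ∀ {a} → 2 ≤ a → ∃ λ m′ → a ≡ suc (suc m′)
two-plus (s≤s (s≤s {n = m′} _)) = m′ , refl

trichotomy : ∀ m → TrichotomyAt m
trichotomy = <-rec TrichotomyAt induction
  where
  induction : ∀ m → (∀ {m′} → m′ < m → TrichotomyAt m′) → TrichotomyAt m
  induction zero    _  C D nlC _ nlD _ _ = inj₁ (two-lattices-equal C D nlC nlD)
  induction (suc m) ih C D nlC lvC nlD lvD sd with m′ , aC ← two-plus (LevelStructure.2≤primeSize C nlC lvC) =
    TrichotomyStep.step C D nlC lvC nlD lvD sd m′ aC (ih (TrichotomyStep.m′<m C D nlC lvC nlD lvD sd m′ aC))

-- Uniqueness: two canonical lattices isomorphic to L are isomorphic to each
-- other, hence (having the same depths) equal or comparable; minimality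
-- rules out comparability.

canonical-unique : ∀ m (L C D : BRel (suc (suc m))) → Canonical C → Canonical D → Iso L C → Iso L D → C ≐ D
canonical-unique m L C D (nlC , lvC , minC) (nlD , lvD , minD) L≅C L≅D =
  decide (trichotomy m C D nlC lvC nlD lvD (iso⇒sameDepths C D nlC lvC nlD lvD C≅D))
  where
  C≅D : Iso C D
  C≅D = iso-trans {R = C} {S = L} {T = D} (iso-sym {R = L} {S = C} L≅C) L≅D
  D≅C : Iso D C
  D≅C = iso-trans {R = D} {S = L} {T = C} (iso-sym {R = L} {S = D} L≅D) L≅C
  decide : Trichotomy C D → C ≐ D
  decide (inj₁ C≐D)        = C≐D
  decide (inj₂ (inj₁ C≺D)) = ⊥-elim (minD C nlC lvC C≅D C≺D)
  decide (inj₂ (inj₂ D≺C)) = ⊥-elim (minC D nlD lvD D≅C D≺C)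

injective⇒surjective : ∀ {n} (f : Fin n → Fin n) → (∀ x y → f x ≡ f y → x ≡ y) → ∀ y → ∃ λ x → f x ≡ y
injective⇒surjective {suc n} f inj y with any? (λ x → f x ≟ y)
... | yes hit = hit
... | no miss = ⊥-elim (<-irrefl refl (injective⇒≤ {f = skip} skip-injective))
  where
  -- Missing y, f factors through Fin n, which is impossible for an injection.
  skip : Fin (suc n) → Fin n
  skip x = punchOut {i = y} {j = f x} (λ e → miss (x , sym e))
  skip-injective : ∀ {x x′} → skip x ≡ skip x′ → x ≡ x′
  skip-injective {x} {x′} e = inj x x′ (punchOut-injective (λ e′ → miss (x , sym e′)) (λ e′ → miss (x′ , sym e′)) e)

injection⇒permutation : ∀ {n} (f : Fin n → Fin n) → (∀ x y → f x ≡ f y → x ≡ y) → Permutation′ n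
injection⇒permutation f inj = permutation f (λ y → proj₁ (injective⇒surjective f inj y))
  (λ y → proj₂ (injective⇒surjective f inj y)) (λ x → inj _ _ (proj₂ (injective⇒surjective f inj (f x))))

-- Keep the least element b₀ first and order the other
-- elements by (depth, label); the position of x in this order is its new
-- label.  The greatest element t₀ is the only element of depth 0, so it
-- receives label 1, and depths increase with the new labels.

count-singleton : ∀ {n} (b : Fin n) → count (λ y → does (y ≟ b)) ≡ 1
count-singleton {suc n} fzero    = cong suc (count-zero {n} (λ y → does (fsuc y ≟ fzero)) (λ y → refl))
count-singleton {suc n} (fsuc b) = count-singleton b

module Levellise {m} (L : BRel (suc (suc m))) (lat : IsLattice L) where
  N : ℕ
  N = suc (suc m)

  open PartialOrder L (proj₁ lat)

  lower-bound : (xs : List (Fin N)) → ∃ λ b → ∀ y → y ∈ xs → L b y ≡ true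
  lower-bound []       = fzero , λ y ()
  lower-bound (x ∷ xs) with b , below ← lower-bound xs
                       with z , (z≤b , z≤x) , _ ← proj₂ (proj₂ lat) b x =
    z , λ { y (Any.here refl) → z≤x ; y (Any.there y∈xs) → R-trans z b y z≤b (below y y∈xs) }

  upper-bound : (xs : List (Fin N)) → ∃ λ t → ∀ y → y ∈ xs → L y t ≡ true
  upper-bound []       = fzero , λ y ()
  upper-bound (x ∷ xs) with t , above ← upper-bound xs
                       with z , (t≤z , x≤z) , _ ← proj₁ (proj₂ lat) t x =
    z , λ { y (Any.here refl) → x≤z ; y (Any.there y∈xs) → R-trans y t z (above y y∈xs) t≤z }

  b₀ t₀ : Fin N
  b₀ = proj₁ (lower-bound (allFin N))
  t₀ = proj₁ (upper-bound (allFin N))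

  b₀-least : ∀ y → L b₀ y ≡ true
  b₀-least y = proj₂ (lower-bound (allFin N)) y (∈-allFin y)

  t₀-greatest : ∀ y → L y t₀ ≡ true
  t₀-greatest y = proj₂ (upper-bound (allFin N)) y (∈-allFin y)

  b₀≢t₀ : b₀ ≢ t₀
  b₀≢t₀ e with () ← trans (R-antisym 𝟎 b₀ (subst (λ w → L 𝟎 w ≡ true) (sym e) (t₀-greatest 𝟎)) (b₀-least 𝟎))
                          (sym (R-antisym 𝟏 b₀ (subst (λ w → L 𝟏 w ≡ true) (sym e) (t₀-greatest 𝟏)) (b₀-least 𝟏)))

  dep-t₀ : dep L t₀ ≡ 0
  dep-t₀ = n≤0⇒n≡0 (dep-lub t₀ 0 (λ b s → ⊥-elim (strict⇒≢ L s (R-antisym t₀ b (strict⇒≤ L s) (t₀-greatest b)))))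

  dep≡0⇒t₀ : ∀ x → dep L x ≡ 0 → x ≡ t₀
  dep≡0⇒t₀ x e with ≤⇒≡⊎strict (t₀-greatest x)
  ... | inj₁ x≡t₀ = x≡t₀
  ... | inj₂ s with () ← ≤-trans (dep-strict s) (≤-reflexive e)

  -- The sort key: b₀ first, then lexicographically by (depth, label).
  keyOf : ∀ x → Dec (x ≡ b₀) → ℕ
  keyOf x (yes _) = 0
  keyOf x (no _)  = suc (dep L x * N + toℕ x)

  key : Fin N → ℕ
  key x = keyOf x (x ≟ b₀)

  key-b₀ : key b₀ ≡ 0
  key-b₀ = at (b₀ ≟ b₀)
    where
    at : ∀ d → keyOf b₀ d ≡ 0
    at (yes _) = refl
    at (no ne) = ⊥-elim (ne refl)

  key-other : ∀ x → x ≢ b₀ → key x ≡ suc (dep L x * N + toℕ x)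
  key-other x x≢b₀ = at (x ≟ b₀)
    where
    at : ∀ d → keyOf x d ≡ suc (dep L x * N + toℕ x)
    at (yes e) = ⊥-elim (x≢b₀ e)
    at (no _)  = refl

  lex< : ∀ x y → dep L x < dep L y → dep L x * N + toℕ x < dep L y * N + toℕ y
  lex< x y lt = begin-strict
    dep L x * N + toℕ x  <⟨ +-monoʳ-< (dep L x * N) (toℕ<n x) ⟩
    dep L x * N + N      ≡⟨ +-comm (dep L x * N) N ⟩
    suc (dep L x) * N    ≤⟨ *-monoˡ-≤ N lt ⟩
    dep L y * N          ≤⟨ m≤m+n (dep L y * N) (toℕ y) ⟩
    dep L y * N + toℕ y  ∎
    where open ≤-Reasoning

  lex-injective : ∀ x y → dep L x * N + toℕ x ≡ dep L y * N + toℕ y → x ≡ y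
  lex-injective x y e with <-cmp (dep L x) (dep L y)
  ... | tri< lt _ _ = ⊥-elim (<-irrefl e (lex< x y lt))
  ... | tri> _ _ gt = ⊥-elim (<-irrefl (sym e) (lex< y x gt))
  ... | tri≈ _ de _ = toℕ-injective (+-cancelˡ-≡ (dep L x * N) (toℕ x) (toℕ y)
                                      (trans e (cong (λ d → d * N + toℕ y) (sym de))))

  key-injective : ∀ x y → key x ≡ key y → x ≡ y
  key-injective x y e with x ≟ b₀ | y ≟ b₀
  ... | yes x≡b₀ | yes y≡b₀ = trans x≡b₀ (sym y≡b₀)
  ... | yes _ | no _  with () ← e
  ... | no _  | yes _ with () ← e
  ... | no _  | no _  = lex-injective x y (suc-injective e)

  -- The new label of x: the number of elements with a smaller key.
  rank : Fin N → ℕ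
  rank x = count (λ y → does (key y <? key x))

  rank-mono : ∀ x y → key x < key y → rank x < rank y
  rank-mono x y lt = count-strict (λ z → does (key z <? key x)) (λ z → does (key z <? key y))
    (λ z z<x → dec-true (key z <? key y) (<-trans (does⇒ (key z <? key x) z<x) lt))
    x (dec-false (key x <? key x) (<-irrefl refl)) (dec-true (key x <? key y) lt)

  rank-injective : ∀ x y → rank x ≡ rank y → x ≡ y
  rank-injective x y e with <-cmp (key x) (key y)
  ... | tri< lt _ _ = ⊥-elim (<-irrefl e (rank-mono x y lt))
  ... | tri> _ _ gt = ⊥-elim (<-irrefl (sym e) (rank-mono y x gt))
  ... | tri≈ _ ke _ = key-injective x y ke

  rank<N : ∀ x → rank x < N
  rank<N x = <-≤-trans
    (count-strict (λ y → does (key y <? key x)) (λ _ → true) (λ _ _ → refl) x (dec-false (key x <? key x) (<-irrefl refl)) refl)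
                       (count-≤ (λ _ → true))

  rank-b₀ : rank b₀ ≡ 0
  rank-b₀ = count-zero (λ y → does (key y <? key b₀))
    (λ y → dec-false (key y <? key b₀) (λ lt → ≤⇒≯ z≤n (subst (key y <_) key-b₀ lt)))

  -- Exactly b₀ has a smaller key than t₀: every other element has depth ≥ 1.
  -- t₀ gets rank 1.
  key-t₀ : key t₀ ≡ suc (dep L t₀ * N + toℕ t₀)
  key-t₀ = key-other t₀ (b₀≢t₀ ∘ sym)

  below-t₀ : ∀ y → does (key y <? key t₀) ≡ does (y ≟ b₀)
  below-t₀ y = at (y ≟ b₀)
    where
    at : (d : Dec (y ≡ b₀)) → does (key y <? key t₀) ≡ does d
    at (yes refl) = dec-true (key b₀ <? key t₀) (subst₂ _<_ (sym key-b₀) (sym key-t₀) (s≤s z≤n))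
    at (no y≢b₀)  = dec-false (key y <? key t₀) (≤⇒≯ (subst₂ _≤_ (sym key-t₀) (sym (key-other y y≢b₀)) (s≤s t₀≤y)))
      where
      t₀≤y : dep L t₀ * N + toℕ t₀ ≤ dep L y * N + toℕ y
      t₀≤y with y ≟ t₀
      ... | yes refl = ≤-refl
      ... | no y≢t₀  = <⇒≤ (lex< t₀ y (subst (_< dep L y) (sym dep-t₀) (n≢0⇒n>0 (y≢t₀ ∘ dep≡0⇒t₀ y))))

  rank-t₀ : rank t₀ ≡ 1
  rank-t₀ = trans (count-cong (λ y → does (key y <? key t₀)) (λ y → does (y ≟ b₀)) below-t₀) (count-singleton b₀)

  label : Fin N → Fin N
  label x = fromℕ< (rank<N x)

  toℕ-label : ∀ x → toℕ (label x) ≡ rank x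
  toℕ-label x = toℕ-fromℕ< (rank<N x)

  label-injective : ∀ x y → label x ≡ label y → x ≡ y
  label-injective x y e = rank-injective x y (trans (sym (toℕ-label x)) (trans (cong toℕ e) (toℕ-label y)))

  π : Permutation′ N
  π = injection⇒permutation label label-injective

  unlabel : Fin N → Fin N
  unlabel = π ⟨$⟩ˡ_

  relabelled : BRel N
  relabelled i j = L (unlabel i) (unlabel j)

  L≅relabelled : Iso L relabelled
  L≅relabelled = π , λ i j → cong₂ L (sym (inverseˡ π)) (sym (inverseˡ π))

  unlabel-rank : ∀ i → rank (unlabel i) ≡ toℕ i
  unlabel-rank i = trans (sym (toℕ-label (unlabel i))) (cong toℕ (inverseʳ π))

  unlabel-at : ∀ x i → toℕ i ≡ rank x → unlabel i ≡ x
  unlabel-at x i e = trans (cong unlabel (toℕ-injective (trans e (sym (toℕ-label x))))) (inverseˡ π)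

  relabelled-nLattice : IsNLattice relabelled
  relabelled-nLattice = iso-lattice L≅relabelled lat ,
    (λ a → subst (λ z → L z (unlabel a) ≡ true) (sym (unlabel-at b₀ 𝟎 (sym rank-b₀))) (b₀-least _)) ,
    (λ a → subst (λ z → L (unlabel a) z ≡ true) (sym (unlabel-at t₀ 𝟏 (sym rank-t₀))) (t₀-greatest _))

  dep-unlabel : ∀ i → dep relabelled i ≡ dep L (unlabel i)
  dep-unlabel = Relabel.dep-relabel relabelled L unlabel label (λ _ → inverseʳ π) (λ _ → inverseˡ π) (λ i j → refl)

  relabelled-levellised : Levellised relabelled
  relabelled-levellised i j 0<i i≤j = subst₂ _≤_ (sym (dep-unlabel i)) (sym (dep-unlabel j)) (≮⇒≥ inverted)
    where
    ≢b₀ : ∀ k → 0 < toℕ k → unlabel k ≢ b₀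
    ≢b₀ k pos e = <-irrefl (trans (sym rank-b₀) (trans (cong rank (sym e)) (unlabel-rank k))) pos
    inverted : ¬ (dep L (unlabel j) < dep L (unlabel i))
    inverted lt = <-irrefl refl (<-≤-trans (subst₂ _<_ (unlabel-rank j) (unlabel-rank i)
      (rank-mono (unlabel j) (unlabel i)
        (subst₂ _<_ (sym (key-other _ (≢b₀ j (≤-trans 0<i i≤j)))) (sym (key-other _ (≢b₀ i 0<i)))
                (s≤s (lex< (unlabel j) (unlabel i) lt))))) i≤j)

functions : ∀ k {B : Set} → List B → List (Fin k → B)
functions zero    bs = Vector.[] ∷ []
functions (suc k) bs = cartesianProductWith Vector._∷_ bs (functions k bs)

functions-complete : ∀ k {B : Set} (bs : List B) (g : Fin k → B) → (∀ i → g i ∈ bs) →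
                     ∃ λ f → f ∈ functions k bs × (∀ i → f i ≡ g i)
functions-complete zero    bs g h = Vector.[] , Any.here refl , λ ()
functions-complete (suc k) bs g h with f , f∈ , f≗ ← functions-complete k bs (g ∘ fsuc) (h ∘ fsuc) =
  g fzero Vector.∷ f , ∈-cartesianProductWith⁺ Vector._∷_ (h fzero) f∈ , λ { fzero → refl ; (fsuc i) → f≗ i }

-- We scan the finite
-- list of all functions Fin n → Fin n, keeping a current candidate and
-- replacing it whenever a strictly smaller admissible relabelling appears.

module Canonicalise {m} (C₀ : BRel (suc (suc m))) (nl₀ : IsNLattice C₀) (lv₀ : Levellised C₀) where
  N : ℕ
  N = suc (suc m)

  along : (Fin N → Fin N) → BRel N
  along f i j = C₀ (f i) (f j)

  Injective : (Fin N → Fin N) → Set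
  Injective f = ∀ x y → f x ≡ f y → x ≡ y

  -- f is injective and makes C₀ a levellised n-lattice (lattice-ness is
  -- automatic for a bijective relabelling).
  Admissible : (Fin N → Fin N) → Set
  Admissible f = Injective f × ((∀ a → along f 𝟎 a ≡ true) × (∀ a → along f a 𝟏 ≡ true)) × Levellised (along f)

  admissible? : ∀ f → Dec (Admissible f)
  admissible? f =
    all? (λ x → all? (λ y → (f x ≟ f y) →-dec (x ≟ y))) ×-dec
    (all? (λ a → along f 𝟎 a Bool.≟ true) ×-dec all? (λ a → along f a 𝟏 Bool.≟ true)) ×-dec
    all? (λ i → all? (λ j → (0 <? toℕ i) →-dec (toℕ i ≤? toℕ j) →-dec (dep (along f) i ≤? dep (along f) j)))

  Candidate : BRel N → Set
  Candidate c = IsNLattice c × Levellised c × Iso c C₀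

  along≅C₀ : ∀ f → Injective f → Iso (along f) C₀
  along≅C₀ f inj = injection⇒permutation f inj , λ i j → refl

  candidate-along : ∀ f → Admissible f → Candidate (along f)
  candidate-along f (inj , ends , lv) =
    (iso-lattice (iso-sym {R = along f} {S = C₀} (along≅C₀ f inj)) (proj₁ nl₀) , ends) , lv , along≅C₀ f inj

  -- Any two candidates are isomorphic, so trichotomy applies.
  candidates-comparable : ∀ {c d} → Candidate c → Candidate d → Trichotomy c d
  candidates-comparable {c} {d} (nlc , lvc , c≅C₀) (nld , lvd , d≅C₀) = trichotomy m c d nlc lvc nld lvd
    (iso⇒sameDepths c d nlc lvc nld lvd (iso-trans {R = c} {S = C₀} {T = d} c≅C₀ (iso-sym {R = d} {S = C₀} d≅C₀)))

  _≼_ : BRel N → BRel N → Set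
  c ≼ d = c ≡ d ⊎ c ≺ d

  ≼-trans : ∀ {c d e} → c ≼ d → d ≼ e → c ≼ e
  ≼-trans (inj₁ refl) d≼e         = d≼e
  ≼-trans (inj₂ c≺d)  (inj₁ refl) = inj₂ c≺d
  ≼-trans (inj₂ c≺d)  (inj₂ d≺e)  = inj₂ (≺-trans c≺d d≺e)

  ≺-≼ : ∀ {b c d} → b ≺ c → c ≼ d → b ≺ d
  ≺-≼ b≺c (inj₁ refl) = b≺c
  ≺-≼ b≺c (inj₂ c≺d)  = ≺-trans b≺c c≺d

  -- A candidate below c that no admissible relabelling along a function in xs undercuts.
  record MinimumOver (xs : List (Fin N → Fin N)) (c : BRel N) : Set where
    field
      minimum   : BRel N
      candidate : Candidate minimum
      below     : minimum ≼ c
      minimal   : ∀ f → f ∈ xs → Admissible f → ¬ (along f ≺ minimum)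

  consider : ∀ f c → Candidate c → Dec (Admissible f) → MinimumOver (f ∷ []) c
  consider f c cc (no ¬adm) = record { minimum = c ; candidate = cc ; below = inj₁ refl
                                     ; minimal = λ { _ (Any.here refl) adm → ⊥-elim (¬adm adm) } }
  consider f c cc (yes adm) = by-cmp (candidates-comparable (candidate-along f adm) cc)
    where
    by-cmp : Trichotomy (along f) c → MinimumOver (f ∷ []) c
    by-cmp (inj₁ f≐c)        = record { minimum = c ; candidate = cc ; below = inj₁ refl
                                      ; minimal = λ { _ (Any.here refl) _ f≺c → ≺-irrefl≐ f≺c f≐c } }
    by-cmp (inj₂ (inj₁ f≺c)) = record { minimum = along f ; candidate = candidate-along f adm ; below = inj₂ f≺c
                                      ; minimal = λ { _ (Any.here refl) _ → ≺-irrefl } }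
    by-cmp (inj₂ (inj₂ c≺f)) = record { minimum = c ; candidate = cc ; below = inj₁ refl
                                      ; minimal = λ { _ (Any.here refl) _ f≺c → ≺-irrefl (≺-trans c≺f f≺c) } }

  minimise : ∀ xs c → Candidate c → MinimumOver xs c
  minimise []       c cc = record { minimum = c ; candidate = cc ; below = inj₁ refl ; minimal = λ _ () }
  minimise (f ∷ xs) c cc = record
    { minimum   = M₂.minimum
    ; candidate = M₂.candidate
    ; below     = ≼-trans M₂.below M₁.below
    ; minimal   = λ { g (Any.here refl) adm g≺ → M₁.minimal g (Any.here refl) adm (≺-≼ g≺ M₂.below)
                    ; g (Any.there g∈) adm g≺ → M₂.minimal g g∈ adm g≺ } }
    where
    module M₁ = MinimumOver (consider f c cc (admissible? f))
    module M₂ = MinimumOver (minimise xs M₁.minimum M₁.candidate)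

  canonical-exists : ∃ λ C → Canonical C × Iso C₀ C
  canonical-exists = M.minimum , (proj₁ M.candidate , proj₁ (proj₂ M.candidate) , minimal) ,
                     iso-sym {R = M.minimum} {S = C₀} (proj₂ (proj₂ M.candidate))
    where
    module M = MinimumOver (minimise (functions N (allFin N)) C₀ (nl₀ , lv₀ , iso-refl {R = C₀}))
    -- Every levellised n-lattice D ≅ C₀ is `along f` for some admissible f in the list.
    minimal : ∀ D → IsNLattice D → Levellised D → Iso D M.minimum → ¬ (D ≺ M.minimum)
    minimal D nlD lvD D≅min D≺min = M.minimal f f∈ admissible (resp≺ D≐along ≐-refl D≺min)
      where
      D≅C₀ : Iso D C₀
      D≅C₀ = iso-trans {R = D} {S = M.minimum} {T = C₀} D≅min (proj₂ (proj₂ M.candidate))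
      σ : Permutation′ N
      σ = proj₁ D≅C₀
      listed : ∃ λ f → f ∈ functions N (allFin N) × (∀ i → f i ≡ σ ⟨$⟩ʳ i)
      listed = functions-complete N (allFin N) (σ ⟨$⟩ʳ_) (λ i → ∈-allFin _)
      f : Fin N → Fin N
      f = proj₁ listed
      f∈ : f ∈ functions N (allFin N)
      f∈ = proj₁ (proj₂ listed)
      D≐along : D ≐ along f
      D≐along i j = trans (proj₂ D≅C₀ i j) (sym (cong₂ C₀ (proj₂ (proj₂ listed) i) (proj₂ (proj₂ listed) j)))
      admissible : Admissible f
      admissible =
        (λ x y e → trans (sym (inverseˡ σ)) (trans (cong (σ ⟨$⟩ˡ_)
          (trans (sym (proj₂ (proj₂ listed) x)) (trans e (proj₂ (proj₂ listed) y)))) (inverseˡ σ))) ,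
        ((λ a → trans (sym (D≐along 𝟎 a)) (proj₁ (proj₂ nlD) a)) ,
         (λ a → trans (sym (D≐along a 𝟏)) (proj₂ (proj₂ nlD) a))) ,
        (λ i j pos le → subst₂ _≤_ (Pointwise.dep≐ D (along f) D≐along i) (Pointwise.dep≐ D (along f) D≐along j)
                                   (lvD i j pos le))

lemma3p7 : ∀ (m : ℕ) (L : BRel (suc (suc m))) → IsLattice L →
    (∃ λ C → Canonical C × Iso L C) ×
    (∀ C D → Canonical C → Canonical D → Iso L C → Iso L D → C ≐ D)
lemma3p7 m L lat =
  (C , canonical , iso-trans {R = L} {S = relabelled} {T = C} L≅relabelled relabelled≅C) ,
  canonical-unique m L
  where
  open Levellise L lat using (relabelled; relabelled-nLattice; relabelled-levellised; L≅relabelled)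
  open Canonicalise relabelled relabelled-nLattice relabelled-levellised using (canonical-exists)
  C : BRel (suc (suc m))
  C = proj₁ canonical-exists
  canonical : Canonical C
  canonical = proj₁ (proj₂ canonical-exists)
  relabelled≅C : Iso relabelled C
  relabelled≅C = proj₂ (proj₂ canonical-exists)
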